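{- Fix integers $2\le r\le k$. There is a constant $c=c(k,r)>0$ such that the following holds. Let $H$ be a $k$-uniform multihypergraph, and suppose there is a vertex subset $W$ with $|W|=n'$ such that the multigraph $G(H)[W]$ has $m'$ edges. Then $H$ has an $r$-cut with excess at least $cm'/n'$.
   Context: A $k$-uniform multihypergraph has a vertex set and a multiset of $k$-element vertex subsets (edges). $G(H)$ denotes the multigraph on $V(H)$ obtained by replacing each edge $e$ of $H$ (with multiplicity) by a clique on the vertex set $e$; $G(H)[W]$ is its induced sub-multigraph on $W$. An $r$-cut is a partition of $V(H)$ into $r$ labelled parts; its size is the number of edges of $H$ (with multiplicity) having a vertex in every part; its excess is its size minus $\frac{S(k,r)r!}{r^k}m$, where $m$ is the number of edges of $H$ and $S(k,r)$ is the Stirling number of the second kind. -}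

module Defs where

open import Data.Bool using (Bool; true; false; _∧_)
open import Data.Nat using (ℕ; zero; suc; _*_; _^_)
open import Data.Nat using (_!)
open import Data.Fin using (Fin; _<?_)
open import Data.Fin.Subset using (Subset; _∈_)
open import Data.Fin.Subset.Properties using (_∈?_)
open import Data.Fin.Properties using (all?; any?)
open import Data.Product using (_×_; _,_; ∃)
open import Data.List using (List; length; filterᵇ; allFin; cartesianProduct; concatMap)
open import Data.Integer using (+_)
open import Data.Rational using (ℚ; 0ℚ; _/_; _-_)
open import Relation.Binary.PropositionalEquality using (_≡_)
open import Relation.Nullary using (does; _×-dec_)
open import Data.Fin using (_≟_)

stirling2 : ℕ → ℕ → ℕ
stirling2 zero    zero    = 1
stirling2 zero    (suc j) = 0
stirling2 (suc n) zero    = 0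
stirling2 (suc n) (suc j) = suc j * stirling2 n (suc j) + stirling2 n j
  where open Data.Nat using (_+_)

-- a / d as a rational; the convention for d = 0 is never used in the statement
-- (there d = r^k with r ≥ 2, or d = n' ≥ 1).
frac : ℕ → ℕ → ℚ
frac a zero    = 0ℚ
frac a (suc d) = (+ a) / suc d

MultiHypergraph : ℕ → Set
MultiHypergraph N = List (Subset N)

-- The edges of G(H): each edge e of H contributes every pair {u,v} ⊆ e with
-- u ≠ v, recorded once as the ordered pair (u , v) with u < v.
cliquePairs : ∀ {N} → Subset N → List (Fin N × Fin N)
cliquePairs {N} e =
  filterᵇ (λ { (u , v) → does (u <? v) ∧ (does (u ∈? e) ∧ does (v ∈? e)) })
          (cartesianProduct (allFin N) (allFin N))

G : ∀ {N} → MultiHypergraph N → List (Fin N × Fin N)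
G H = concatMap cliquePairs H

induced : ∀ {N} → List (Fin N × Fin N) → Subset N → List (Fin N × Fin N)
induced E W = filterᵇ (λ { (u , v) → does (u ∈? W) ∧ does (v ∈? W) }) E

inducedEdgeCount : ∀ {N} → MultiHypergraph N → Subset N → ℕ
inducedEdgeCount H W = length (induced (G H) W)

-- An r-cut: a partition of the vertices into r labelled (possibly empty) parts.
Cut : ℕ → ℕ → Set
Cut N r = Fin N → Fin r

cutsEdge : ∀ {N r} → Cut N r → Subset N → Bool
cutsEdge {N} {r} f e = does (all? (λ i → any? (λ v → (v ∈? e) ×-dec (f v ≟ i))))

cutSize : ∀ {N r} → MultiHypergraph N → Cut N r → ℕ
cutSize H f = length (filterᵇ (cutsEdge f) H)

excess : ∀ {N} (k r : ℕ) → MultiHypergraph N → Cut N r → ℚ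
excess k r H f =
  frac (cutSize H f) 1 - frac (stirling2 k r * (r !) * length H) (r ^ k)

module Submission where

-- A uniformly random cut into r parts cuts each edge with probability S(k,r) r! / r^k, so it
-- suffices to find a distribution on cuts that beats this by c m'/n' in expectation.
-- Let μ pair some vertices x with earlier partners u that are themselves unpaired. Take a
-- uniform colouring h and switch every paired x whose colour equals that of its partner u to
-- the colour σ (h u), where σ swaps the colours 0 and 1. Switching one x never lowers the
-- probability that an edge e is cut: if u ∈ e every colour present on e survives, and if
-- u ∉ e the new colour of x is again uniform and independent of the rest of e. If both u and
-- x lie in e, the colourings of e using 0 on u and x, all of 2, …, r - 1 elsewhere and never
-- 1 are not cut before the switch but are after it, which gains r^(-k) for e. So some cut has
-- excess at least r^(-k) times the number of edges containing a pair of μ.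
-- The pairs u < v of W are covered by the 2n' matchings {rank u + rank v = c}, and an edge
-- spans at most k² pairs of G(H)[W], so one of these matchings is spanned by at least
-- m' / (2 k² n') edges; hence c = 1 / (2 k² r^k) works.

open import Defs

-- Anonymous modules keep the arithmetic of ℕ apart from that of ℚ used in the statement.
module _ where

  open import Data.Bool using (Bool; true; false; T; _∧_; _∨_) renaming (_≟_ to _≟ᵇ_)
  open import Data.Bool.Properties using (∨-identityʳ; ∨-zeroʳ; ∨-assoc; ∨-comm)
  open import Data.Nat hiding (_≟_)
  open import Data.Nat using () renaming (_≟_ to _≟ℕ_)
  open import Data.Nat.Solver using (module +-*-Solver)
  open import Data.Nat.Properties hiding (_≟_)
  open import Algebra.Properties.CommutativeSemigroup *-commutativeSemigroup using (x∙yz≈y∙xz)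
  open import Data.Fin using (Fin; zero; suc; toℕ; fromℕ<; punchIn; _≟_) renaming (_<?_ to _<ᶠ?_)
  open import Data.Fin.Properties using (punchInᵢ≢i; toℕ-injective; toℕ<n; fromℕ<-toℕ; toℕ-fromℕ<; all?; any?)
  open import Data.Fin.Subset using (Subset; _∈_; _∉_; ⊥; ⊤; ⁅_⁆; _∪_; _-_; ∣_∣)
  open import Data.Fin.Subset.Properties
    using (_∈?_; ∈⊤; ⊆⊤; ⊆-antisym; x∈⁅x⁆; x∈⁅y⁆⇒x≡y; ∉⊥; x∈p∪q⁻; x∈p∪q⁺; p─⊥≡p; p─q⊆p; x∈p∧x≢y⇒x∈p-y; ∣⊤∣≡n; ∪-identityˡ)
  open import Data.Vec using (_∷_; []; here; there)
  open import Data.Vec.Properties using (≡-dec)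
  open import Data.Vec.Functional using (updateAt) renaming (_∷_ to _◂_)
  open import Data.Vec.Functional.Properties using (updateAt-updates; updateAt-minimal; updateAt-updateAt; updateAt-commutes)
  open import Data.Product using (∃; _×_; _,_; proj₁; proj₂)
  open import Data.Sum using (inj₁; inj₂)
  open import Data.Maybe using (Maybe; just; nothing)
  open import Data.List using (List; []; _∷_; _++_; allFin; length; filter; filterᵇ; map; tabulate; cartesianProduct)
  open import Data.List.Properties using (length-++; filter-++; map-tabulate)
  open import Data.List.Relation.Unary.All using (All; []; _∷_)
  open import Data.List.Membership.Propositional.Properties using (∈-allFin)
  open import Function using (id; const; _∘_; case_of_)
  open import Relation.Binary.PropositionalEquality
  open import Relation.Binary using (tri<; tri≈; tri>)
  open import Relation.Nullary using (yes; no; does; ¬_; Dec; _×-dec_; _→-dec_; contradiction)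
  open import Relation.Nullary.Decidable using (dec-true; map′; T?)
  open import Algebra.Properties.Semiring.Sum +-*-semiring
    using (sum; sum-syntax; sum-cong-≗; sum-remove; ∑-distrib-+; ∑-comm; ∑-permute; *-distribˡ-sum; *-distribʳ-sum)
  open import Data.Fin.Permutation.Components using (transpose)
  import Data.Fin.Permutation as Perm

  𝟙 : Bool → ℕ
  𝟙 true  = 1
  𝟙 false = 0

  𝟙-does-mono : ∀ {P Q : Set} (p : Dec P) (q : Dec Q) → (P → Q) → 𝟙 (does p) ≤ 𝟙 (does q)
  𝟙-does-mono (no _)  _       _   = z≤n
  𝟙-does-mono (yes _) (yes _) _   = ≤-refl
  𝟙-does-mono (yes p) (no ¬q) p⇒q = contradiction (p⇒q p) ¬q

  𝟙-does-yes : ∀ {P : Set} (p : Dec P) → P → 𝟙 (does p) ≡ 1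
  𝟙-does-yes (yes _) _  = refl
  𝟙-does-yes (no ¬p) p = contradiction p ¬p

  𝟙-does-no : ∀ {P : Set} (p : Dec P) → ¬ P → 𝟙 (does p) ≡ 0
  𝟙-does-no (yes p) ¬p = contradiction p ¬p
  𝟙-does-no (no _)  _  = refl

  𝟙-does-cong : ∀ {P Q : Set} (p : Dec P) (q : Dec Q) → (P → Q) → (Q → P) → 𝟙 (does p) ≡ 𝟙 (does q)
  𝟙-does-cong p q p⇒q q⇒p = ≤-antisym (𝟙-does-mono p q p⇒q) (𝟙-does-mono q p q⇒p)

  𝟙-×-dec : ∀ {P Q : Set} (p : Dec P) (q : Dec Q) → 𝟙 (does (p ×-dec q)) ≡ 𝟙 (does p) * 𝟙 (does q)
  𝟙-×-dec p q with does p
  ... | true  = sym (+-identityʳ _)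
  ... | false = refl

  𝟙-∧ : ∀ a b → 𝟙 (a ∧ b) ≡ 𝟙 a * 𝟙 b
  𝟙-∧ true  b = sym (+-identityʳ (𝟙 b))
  𝟙-∧ false b = refl

  𝟙-∧-≤ˡ : ∀ a b → 𝟙 (a ∧ b) ≤ 𝟙 a
  𝟙-∧-≤ˡ true  b = 𝟙≤1 b
    where 𝟙≤1 : ∀ b → 𝟙 b ≤ 1
          𝟙≤1 true  = ≤-refl
          𝟙≤1 false = z≤n
  𝟙-∧-≤ˡ false b = z≤n

  𝟙-∧-≤ʳ : ∀ a b → 𝟙 (a ∧ b) ≤ 𝟙 b
  𝟙-∧-≤ʳ true  b = ≤-refl
  𝟙-∧-≤ʳ false b = z≤n

  infixl 6 _[_]≔_
  _[_]≔_ : ∀ {n} {A : Set} → (Fin n → A) → Fin n → A → Fin n → A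
  h [ u ]≔ a = updateAt h u (const a)

  ∑-const : ∀ n c → ∑[ i < n ] c ≡ n * c
  ∑-const zero    c = refl
  ∑-const (suc n) c = cong (c +_) (∑-const n c)

  ∑-mono-≤ : ∀ n {f g : Fin n → ℕ} → (∀ i → f i ≤ g i) → sum f ≤ sum g
  ∑-mono-≤ zero    f≤g = z≤n
  ∑-mono-≤ (suc n) f≤g = +-mono-≤ (f≤g zero) (∑-mono-≤ n (f≤g ∘ suc))

  term≤∑ : ∀ {n} (f : Fin n → ℕ) i → f i ≤ sum f
  term≤∑ f zero    = m≤m+n (f zero) _
  term≤∑ f (suc i) = ≤-trans (term≤∑ (f ∘ suc) i) (m≤n+m _ (f zero))

  ∑-positive : ∀ {n} (f : Fin n → ℕ) → 0 < sum f → ∃ λ i → 0 < f i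
  ∑-positive {suc n} f 0<∑ with f zero in f0≡
  ... | suc _ = zero , subst (0 <_) (sym f0≡) (s≤s z≤n)
  ... | zero  with ∑-positive (f ∘ suc) 0<∑
  ...   | i , 0<fi = suc i , 0<fi


  ≤-from-positive : ∀ {m n} → (0 < m → m ≤ n) → m ≤ n
  ≤-from-positive {zero}  _   = z≤n
  ≤-from-positive {suc m} m≤n = m≤n (s≤s z≤n)

  ∑-updateAt : ∀ {n} (f : Fin n → ℕ) i c → sum (f [ i ]≔ c) + f i ≡ sum f + c
  ∑-updateAt {suc n} f i c = begin
    sum (f [ i ]≔ c) + f i                             ≡⟨ cong (_+ f i) (sum-remove (f [ i ]≔ c)) ⟩
    (f [ i ]≔ c) i + sum (λ j → (f [ i ]≔ c) (punchIn i j)) + f i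
      ≡⟨ cong₂ (λ x y → x + y + f i) (updateAt-updates i f) (sum-cong-≗ untouched) ⟩
    c + sum (f ∘ punchIn i) + f i                      ≡⟨ +-assoc c _ (f i) ⟩
    c + (sum (f ∘ punchIn i) + f i)                    ≡⟨ +-comm c _ ⟩
    sum (f ∘ punchIn i) + f i + c                      ≡⟨ cong (_+ c) (trans (+-comm _ (f i)) (sym (sum-remove f))) ⟩
    sum f + c                                          ∎
    where
    open ≡-Reasoning
    untouched : ∀ j → (f [ i ]≔ c) (punchIn i j) ≡ f (punchIn i j)
    untouched j = updateAt-minimal (punchIn i j) i f (punchInᵢ≢i i j)

  ∑-δ : ∀ {n} (c : Fin n) Y → ∑[ a < n ] (𝟙 (does (a ≟ c)) * Y) ≡ Y
  ∑-δ {suc n} zero    Y = trans (cong₂ _+_ (+-identityʳ Y) (trans (∑-const n 0) (*-zeroʳ n))) (+-identityʳ Y)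
  ∑-δ {suc n} (suc c) Y = ∑-δ c Y

  ∃-term≥average : ∀ n .{{_ : NonZero n}} (f : Fin n → ℕ) → ∃ λ i → sum f ≤ n * f i
  ∃-term≥average (suc zero)    f = zero , ≤-refl
  ∃-term≥average (suc (suc n)) f with ∃-term≥average (suc n) (f ∘ suc)
  ... | i , ∑≤ with f zero ≤? f (suc i)
  ...   | yes f0≤ = suc i , +-mono-≤ f0≤ ∑≤
  ...   | no  f0≰ = zero , +-monoʳ-≤ (f zero) (≤-trans ∑≤ (*-monoʳ-≤ (suc n) (<⇒≤ (≰⇒> f0≰))))

  ◂-congʳ : ∀ {n} {A : Set} (a : A) {h h' : Fin n → A} → h ≗ h' → a ◂ h ≗ a ◂ h'
  ◂-congʳ a h≗h' zero    = refl
  ◂-congʳ a h≗h' (suc i) = h≗h' i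

  ◂-updateAt-zero : ∀ {n} {A : Set} (b : A) (h : Fin n → A) a → (b ◂ h) [ zero ]≔ a ≗ a ◂ h
  ◂-updateAt-zero b h a zero    = refl
  ◂-updateAt-zero b h a (suc i) = refl

  ◂-updateAt-suc : ∀ {n} {A : Set} (b : A) (h : Fin n → A) u a → (b ◂ h) [ suc u ]≔ a ≗ b ◂ (h [ u ]≔ a)
  ◂-updateAt-suc b h u a zero    = refl
  ◂-updateAt-suc b h u a (suc i) = refl

  []≔-congˡ : ∀ {n} {A : Set} {h h' : Fin n → A} → h ≗ h' → ∀ u a → h [ u ]≔ a ≗ h' [ u ]≔ a
  []≔-congˡ h≗h' u a y with y ≟ u
  ... | yes refl = trans (updateAt-updates y _) (sym (updateAt-updates y _))
  ... | no  y≢u  = trans (updateAt-minimal y u _ y≢u) (trans (h≗h' y) (sym (updateAt-minimal y u _ y≢u)))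

  ∣x∷p∣ : ∀ {n} x (p : Subset n) → ∣ x ∷ p ∣ ≡ 𝟙 x + ∣ p ∣
  ∣x∷p∣ true  p = refl
  ∣x∷p∣ false p = refl

  ∣p∣≡∑ : ∀ {n} (p : Subset n) → ∣ p ∣ ≡ ∑[ i < n ] 𝟙 (does (i ∈? p))
  ∣p∣≡∑ []          = refl
  ∣p∣≡∑ (true ∷ p)  = cong suc (∣p∣≡∑ p)
  ∣p∣≡∑ (false ∷ p) = ∣p∣≡∑ p

  ∣p-x∣+1≡∣p∣ : ∀ {n} (p : Subset n) {x} → x ∈ p → suc ∣ (p - x) ∣ ≡ ∣ p ∣
  ∣p-x∣+1≡∣p∣ (true ∷ p)  here       = cong (suc ∘ ∣_∣) (p─⊥≡p p)
  ∣p-x∣+1≡∣p∣ (b ∷ p) {suc x} (there x∈p) =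
    trans (cong suc (∣x∷p∣ b (p - x))) (trans (sym (+-suc (𝟙 b) _)) (trans (cong (𝟙 b +_) (∣p-x∣+1≡∣p∣ p x∈p)) (sym (∣x∷p∣ b p))))

  x∈p-y⇒x≢y : ∀ {n} (p : Subset n) {x y} → x ∈ p - y → x ≢ y
  x∈p-y⇒x≢y (b ∷ p) {zero}  {zero}  ()
  x∈p-y⇒x≢y (b ∷ p) {zero}  {suc y} _              ()
  x∈p-y⇒x≢y (b ∷ p) {suc x} {zero}  _              ()
  x∈p-y⇒x≢y (b ∷ p) {suc x} {suc y} (there x∈p-y) refl = x∈p-y⇒x≢y p x∈p-y refl

  ∑-∈-const : ∀ {n} (p : Subset n) (f : Fin n → ℕ) c → (∀ {i} → i ∈ p → f i ≡ c) →
    ∑[ i < n ] (𝟙 (does (i ∈? p)) * f i) ≡ ∣ p ∣ * c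
  ∑-∈-const []          f c f≡c = refl
  ∑-∈-const (true ∷ p)  f c f≡c =
    cong₂ _+_ (trans (+-identityʳ (f zero)) (f≡c here)) (∑-∈-const p (f ∘ suc) c (f≡c ∘ there))
  ∑-∈-const (false ∷ p) f c f≡c = ∑-∈-const p (f ∘ suc) c (f≡c ∘ there)

  infix 4 _≟ˢ_
  _≟ˢ_ : ∀ {n} (p q : Subset n) → Dec (p ≡ q)
  _≟ˢ_ = ≡-dec _≟ᵇ_

  rank : ∀ {n} → Subset n → Fin n → ℕ
  rank (b ∷ p) zero    = 0
  rank (b ∷ p) (suc v) = 𝟙 b + rank p v

  rank<∣p∣ : ∀ {n} (p : Subset n) {v} → v ∈ p → rank p v < ∣ p ∣
  rank<∣p∣ (true ∷ p) here        = s≤s z≤n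
  rank<∣p∣ (b ∷ p) {suc v} (there v∈p) = subst (𝟙 b + rank p v <_) (sym (∣x∷p∣ b p)) (+-monoʳ-< (𝟙 b) (rank<∣p∣ p v∈p))

  rank-surjective : ∀ {n} (p : Subset n) {t} → t < ∣ p ∣ → ∃ λ v → v ∈ p × rank p v ≡ t
  rank-surjective (true ∷ p)  {zero}  _ = zero , here , refl
  rank-surjective (true ∷ p)  {suc t} t<∣p∣ with rank-surjective p (≤-pred t<∣p∣)
  ... | v , v∈p , refl = suc v , there v∈p , refl
  rank-surjective (false ∷ p) t<∣p∣ with rank-surjective p t<∣p∣
  ... | v , v∈p , refl = suc v , there v∈p , refl

  rank-strictMono : ∀ {n} (p : Subset n) {v w} → v ∈ p → toℕ v < toℕ w → rank p v < rank p w
  rank-strictMono (true ∷ p) {zero} {suc w} here        _   = s≤s z≤n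
  rank-strictMono (b ∷ p)    {suc v} {suc w} (there v∈p) v<w = +-monoʳ-< (𝟙 b) (rank-strictMono p v∈p (≤-pred v<w))

  rank-injective : ∀ {n} (p : Subset n) {v w} → v ∈ p → w ∈ p → rank p v ≡ rank p w → v ≡ w
  rank-injective p {v} {w} v∈p w∈p eq with <-cmp (toℕ v) (toℕ w)
  ... | tri< v<w _ _ = contradiction eq (<⇒≢ (rank-strictMono p v∈p v<w))
  ... | tri≈ _ v≡w _ = toℕ-injective v≡w
  ... | tri> _ _ w<v = contradiction (sym eq) (<⇒≢ (rank-strictMono p w∈p w<v))

  length-filter-∷ : ∀ {A : Set} {P : A → Set} (P? : ∀ a → Dec (P a)) a as →
    length (filter P? (a ∷ as)) ≡ 𝟙 (does (P? a)) + length (filter P? as)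
  length-filter-∷ P? a as with does (P? a)
  ... | true  = refl
  ... | false = refl

  length-filter-++ : ∀ {A : Set} {P : A → Set} (P? : ∀ a → Dec (P a)) xs ys →
    length (filter P? (xs ++ ys)) ≡ length (filter P? xs) + length (filter P? ys)
  length-filter-++ P? xs ys = trans (cong length (filter-++ P? xs ys)) (length-++ (filter P? xs))

  filterᵇ-filterᵇ : ∀ {A : Set} (p q : A → Bool) xs → filterᵇ p (filterᵇ q xs) ≡ filterᵇ (λ a → q a ∧ p a) xs
  filterᵇ-filterᵇ p q []       = refl
  filterᵇ-filterᵇ p q (a ∷ as) with q a
  ... | false = filterᵇ-filterᵇ p q as
  ... | true with p a
  ...   | false = filterᵇ-filterᵇ p q as
  ...   | true  = cong (a ∷_) (filterᵇ-filterᵇ p q as)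

  length-filterᵇ-tabulate : ∀ {A : Set} {n} (p : A → Bool) (f : Fin n → A) →
    length (filterᵇ p (tabulate f)) ≡ ∑[ i < n ] 𝟙 (p (f i))
  length-filterᵇ-tabulate {n = zero}  p f = refl
  length-filterᵇ-tabulate {n = suc n} p f =
    trans (length-filter-∷ (T? ∘ p) (f zero) _) (cong (𝟙 (p (f zero)) +_) (length-filterᵇ-tabulate p (f ∘ suc)))

  length-filterᵇ-cartesianProduct : ∀ {A B : Set} {m n} (p : A × B → Bool) (f : Fin m → A) (g : Fin n → B) →
    length (filterᵇ p (cartesianProduct (tabulate f) (tabulate g))) ≡ ∑[ i < m ] ∑[ j < n ] 𝟙 (p (f i , g j))
  length-filterᵇ-cartesianProduct {m = zero}  p f g = refl
  length-filterᵇ-cartesianProduct {m = suc m} {n} p f g = begin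
    length (filterᵇ p (map (f zero ,_) (tabulate g) ++ cartesianProduct (tabulate (f ∘ suc)) (tabulate g)))
      ≡⟨ length-filter-++ (T? ∘ p) (map (f zero ,_) (tabulate g)) _ ⟩
    length (filterᵇ p (map (f zero ,_) (tabulate g))) + length (filterᵇ p (cartesianProduct (tabulate (f ∘ suc)) (tabulate g)))
      ≡⟨ cong₂ _+_ (trans (cong (length ∘ filterᵇ p) (map-tabulate g (f zero ,_))) (length-filterᵇ-tabulate p (λ j → f zero , g j)))
                   (length-filterᵇ-cartesianProduct p (f ∘ suc) g) ⟩
    ∑[ i < suc m ] ∑[ j < n ] 𝟙 (p (f i , g j)) ∎
    where open ≡-Reasoning

  -- Sums over all cuts

  ∑Cut : (N r : ℕ) → (Cut N r → ℕ) → ℕ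
  ∑Cut zero    r G = G (λ ())
  ∑Cut (suc N) r G = ∑[ a < r ] ∑Cut N r (λ h → G (a ◂ h))

  Extensional : ∀ {N r} → (Cut N r → ℕ) → Set
  Extensional G = ∀ {h h'} → h ≗ h' → G h ≡ G h'

  module _ (r : ℕ) where

    ∑Cut-cong : ∀ N {G G' : Cut N r → ℕ} → (∀ h → G h ≡ G' h) → ∑Cut N r G ≡ ∑Cut N r G'
    ∑Cut-cong zero    G≡G' = G≡G' _
    ∑Cut-cong (suc N) G≡G' = sum-cong-≗ (λ a → ∑Cut-cong N (G≡G' ∘ (a ◂_)))

    ∑Cut-mono-≤ : ∀ N {G G' : Cut N r → ℕ} → (∀ h → G h ≤ G' h) → ∑Cut N r G ≤ ∑Cut N r G'
    ∑Cut-mono-≤ zero    G≤G' = G≤G' _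
    ∑Cut-mono-≤ (suc N) G≤G' = ∑-mono-≤ r (λ a → ∑Cut-mono-≤ N (G≤G' ∘ (a ◂_)))

    ∑Cut-distrib-+ : ∀ N (G G' : Cut N r → ℕ) → ∑Cut N r (λ h → G h + G' h) ≡ ∑Cut N r G + ∑Cut N r G'
    ∑Cut-distrib-+ zero    G G' = refl
    ∑Cut-distrib-+ (suc N) G G' =
      trans (sum-cong-≗ (λ a → ∑Cut-distrib-+ N (G ∘ (a ◂_)) (G' ∘ (a ◂_))))
            (∑-distrib-+ (λ a → ∑Cut N r (G ∘ (a ◂_))) (λ a → ∑Cut N r (G' ∘ (a ◂_))))

    *-distribˡ-∑Cut : ∀ N c (G : Cut N r → ℕ) → c * ∑Cut N r G ≡ ∑Cut N r (λ h → c * G h)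
    *-distribˡ-∑Cut zero    c G = refl
    *-distribˡ-∑Cut (suc N) c G =
      trans (*-distribˡ-sum c (λ a → ∑Cut N r (G ∘ (a ◂_)))) (sum-cong-≗ (λ a → *-distribˡ-∑Cut N c (G ∘ (a ◂_))))

    ∑Cut-comm-∑ : ∀ N m (G : Fin m → Cut N r → ℕ) →
      ∑Cut N r (λ h → ∑[ i < m ] G i h) ≡ ∑[ i < m ] ∑Cut N r (G i)
    ∑Cut-comm-∑ zero    m G = refl
    ∑Cut-comm-∑ (suc N) m G =
      trans (sum-cong-≗ (λ a → ∑Cut-comm-∑ N m (λ i h → G i (a ◂ h)))) (∑-comm (λ a i → ∑Cut N r (λ h → G i (a ◂ h))))

    ∑Cut-updateAt : ∀ N (u : Fin N) (G : Cut N r → ℕ) → Extensional G →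
      ∑Cut N r (λ h → ∑[ a < r ] G (h [ u ]≔ a)) ≡ r * ∑Cut N r G
    ∑Cut-updateAt (suc N) zero G ext = begin
      ∑[ b < r ] ∑Cut N r (λ h → ∑[ a < r ] G ((b ◂ h) [ zero ]≔ a))
        ≡⟨ sum-cong-≗ (λ b → ∑Cut-cong N (λ h → sum-cong-≗ (λ a → ext (◂-updateAt-zero b h a)))) ⟩
      ∑[ b < r ] ∑Cut N r (λ h → ∑[ a < r ] G (a ◂ h))
        ≡⟨ cong (λ x → ∑[ b < r ] x) (∑Cut-comm-∑ N r (λ a h → G (a ◂ h))) ⟩
      ∑[ b < r ] ∑[ a < r ] ∑Cut N r (G ∘ (a ◂_))
        ≡⟨ ∑-const r _ ⟩
      r * ∑Cut (suc N) r G ∎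
      where open ≡-Reasoning
    ∑Cut-updateAt (suc N) (suc u) G ext = begin
      ∑[ b < r ] ∑Cut N r (λ h → ∑[ a < r ] G ((b ◂ h) [ suc u ]≔ a))
        ≡⟨ sum-cong-≗ (λ b → ∑Cut-cong N (λ h → sum-cong-≗ (λ a → ext (◂-updateAt-suc b h u a)))) ⟩
      ∑[ b < r ] ∑Cut N r (λ h → ∑[ a < r ] G (b ◂ (h [ u ]≔ a)))
        ≡⟨ sum-cong-≗ (λ b → ∑Cut-updateAt N u (G ∘ (b ◂_)) (ext ∘ ◂-congʳ b)) ⟩
      ∑[ b < r ] (r * ∑Cut N r (G ∘ (b ◂_)))
        ≡⟨ *-distribˡ-sum r (λ b → ∑Cut N r (G ∘ (b ◂_))) ⟨
      r * ∑Cut (suc N) r G ∎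
      where open ≡-Reasoning

  ∃-cut≥average : ∀ N r (G : Cut N (suc r) → ℕ) → ∃ λ h → ∑Cut N (suc r) G ≤ suc r ^ N * G h
  ∃-cut≥average zero    r G = (λ ()) , ≤-reflexive (sym (+-identityʳ _))
  ∃-cut≥average (suc N) r G with ∃-term≥average (suc r) (λ a → ∑Cut N (suc r) (G ∘ (a ◂_)))
  ... | a , ∑≤ with ∃-cut≥average N r (G ∘ (a ◂_))
  ...   | h , ∑h≤ = (a ◂ h) , ≤-trans ∑≤ (≤-trans (*-monoʳ-≤ (suc r) ∑h≤)
                                (≤-reflexive (sym (*-assoc (suc r) (suc r ^ N) (G (a ◂ h))))))

  Covers : ∀ {N r} → Cut N r → Subset N → Set
  Covers f e = ∀ i → ∃ λ v → v ∈ e × f v ≡ i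

  covers? : ∀ {N r} (f : Cut N r) e → Dec (Covers f e)
  covers? f e = all? λ i → any? λ v → (v ∈? e) ×-dec (f v ≟ i)

  χ : ∀ {N r} → Subset N → Cut N r → ℕ
  χ e f = 𝟙 (does (covers? f e))

  module _ {N r : ℕ} (e : Subset N) where

    χ-mono : ∀ {f g : Cut N r} → (Covers f e → Covers g e) → χ e f ≤ χ e g
    χ-mono {f} {g} = 𝟙-does-mono (covers? f e) (covers? g e)

    χ≡1 : ∀ {f : Cut N r} → Covers f e → χ e f ≡ 1
    χ≡1 {f} = 𝟙-does-yes (covers? f e)

    χ≡0 : ∀ {f : Cut N r} → ¬ Covers f e → χ e f ≡ 0
    χ≡0 {f} = 𝟙-does-no (covers? f e)

    χ-local : ∀ {f g : Cut N r} → (∀ {v} → v ∈ e → f v ≡ g v) → χ e f ≡ χ e g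
    χ-local f≡g = ≤-antisym (χ-mono (transport f≡g)) (χ-mono (transport (sym ∘ f≡g)))
      where
      transport : ∀ {f g : Cut N r} → (∀ {v} → v ∈ e → f v ≡ g v) → Covers f e → Covers g e
      transport f≡g cov i with cov i
      ... | v , v∈e , fv≡i = v , v∈e , trans (sym (f≡g v∈e)) fv≡i

    χ-ext : Extensional (χ {r = r} e)
    χ-ext f≗g = χ-local (λ {v} _ → f≗g v)

  image : ∀ {N r} → Cut N r → Subset N → Subset r
  image h []          = ⊥
  image h (true ∷ e)  = ⁅ h zero ⁆ ∪ image (h ∘ suc) e
  image h (false ∷ e) = image (h ∘ suc) e

  image-sound : ∀ {N r} (h : Cut N r) e {i} → i ∈ image h e → ∃ λ v → v ∈ e × h v ≡ i
  image-sound h []          i∈ = contradiction i∈ ∉⊥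
  image-sound h (false ∷ e) i∈ with image-sound (h ∘ suc) e i∈
  ... | v , v∈e , hv≡i = suc v , there v∈e , hv≡i
  image-sound h (true ∷ e)  i∈ with x∈p∪q⁻ ⁅ h zero ⁆ (image (h ∘ suc) e) i∈
  ... | inj₁ i∈⁅h0⁆ = zero , here , sym (x∈⁅y⁆⇒x≡y (h zero) i∈⁅h0⁆)
  ... | inj₂ i∈rest with image-sound (h ∘ suc) e i∈rest
  ...   | v , v∈e , hv≡i = suc v , there v∈e , hv≡i

  image-complete : ∀ {N r} (h : Cut N r) e {v} → v ∈ e → h v ∈ image h e
  image-complete h (true ∷ e)  here        = x∈p∪q⁺ (inj₁ (x∈⁅x⁆ (h zero)))
  image-complete h (true ∷ e)  (there v∈e) = x∈p∪q⁺ (inj₂ (image-complete (h ∘ suc) e v∈e))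
  image-complete h (false ∷ e) (there v∈e) = image-complete (h ∘ suc) e v∈e

  χ≡𝟙[image≡⊤] : ∀ {N r} e (h : Cut N r) → χ e h ≡ 𝟙 (does (image h e ≟ˢ ⊤))
  χ≡𝟙[image≡⊤] e h = 𝟙-does-cong (covers? h e) (image h e ≟ˢ ⊤) covers⇒full full⇒covers
    where
    covers⇒full : Covers h e → image h e ≡ ⊤
    covers⇒full cov = ⊆-antisym ⊆⊤ λ {i} _ → hit (cov i)
      where
      hit : ∀ {i} → ∃ (λ v → v ∈ e × h v ≡ i) → i ∈ image h e
      hit (v , v∈e , refl) = image-complete h e v∈e
    full⇒covers : image h e ≡ ⊤ → Covers h e
    full⇒covers full i = image-sound h e (subst (i ∈_) (sym full) ∈⊤)

  -- Counting surjective colourings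

  surjections : ℕ → ℕ → ℕ
  surjections zero    zero    = 1
  surjections zero    (suc m) = 0
  surjections (suc n) m       = m * (surjections n m + surjections n (pred m))

  surjections≡!*stirling2 : ∀ n m → surjections n m ≡ m ! * stirling2 n m
  surjections≡!*stirling2 zero    zero    = refl
  surjections≡!*stirling2 zero    (suc m) = sym (*-zeroʳ (suc m !))
  surjections≡!*stirling2 (suc n) zero    = refl
  surjections≡!*stirling2 (suc n) (suc m)
    rewrite surjections≡!*stirling2 n (suc m) | surjections≡!*stirling2 n m =
    solve 4 (λ s f a b → s :* (s :* f :* a :+ f :* b) := s :* f :* (s :* a :+ b))
            refl (suc m) (m !) (stirling2 n (suc m)) (stirling2 n m)
    where open +-*-Solver

  𝟙[⁅a⁆∪J≡I] : ∀ {r} (a : Fin r) (J I : Subset r) →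
    𝟙 (does (⁅ a ⁆ ∪ J ≟ˢ I)) ≡ 𝟙 (does (a ∈? I)) * (𝟙 (does (J ≟ˢ I)) + 𝟙 (does (J ≟ˢ I - a)))
  𝟙[⁅a⁆∪J≡I] zero (j ∷ J) (true ∷ I) rewrite ∪-identityˡ J =
    trans (by-colour j) (cong (λ K → 1 * (𝟙 (does (j ∷ J ≟ˢ true ∷ I)) + 𝟙 (does (j ∷ J ≟ˢ false ∷ K))))
                              (sym (p─⊥≡p I)))
    where
    by-colour : ∀ j → 𝟙 (does (J ≟ˢ I)) ≡ 1 * (𝟙 (does (j ∷ J ≟ˢ true ∷ I)) + 𝟙 (does (j ∷ J ≟ˢ false ∷ I)))
    by-colour true  = sym (trans (+-identityʳ _) (+-identityʳ _))
    by-colour false = sym (+-identityʳ _)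
  𝟙[⁅a⁆∪J≡I] zero    (j ∷ J)     (false ∷ I) = refl
  𝟙[⁅a⁆∪J≡I] (suc a) (true ∷ J)  (true ∷ I)  = 𝟙[⁅a⁆∪J≡I] a J I
  𝟙[⁅a⁆∪J≡I] (suc a) (false ∷ J) (false ∷ I) = 𝟙[⁅a⁆∪J≡I] a J I
  𝟙[⁅a⁆∪J≡I] (suc a) (true ∷ J)  (false ∷ I) = sym (*-zeroʳ (𝟙 (does (a ∈? I))))
  𝟙[⁅a⁆∪J≡I] (suc a) (false ∷ J) (true ∷ I)  = sym (*-zeroʳ (𝟙 (does (a ∈? I))))

  ∑Cut-image≡ : ∀ N r (e : Subset N) (I : Subset r) →
    r ^ ∣ e ∣ * ∑Cut N r (λ h → 𝟙 (does (image h e ≟ˢ I))) ≡ r ^ N * surjections ∣ e ∣ ∣ I ∣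
  ∑Cut-image≡ zero    r []          I = cong (_+ 0) (base I)
    where
    base : ∀ {r} (I : Subset r) → 𝟙 (does (⊥ ≟ˢ I)) ≡ surjections 0 ∣ I ∣
    base []          = refl
    base (true ∷ I)  = refl
    base (false ∷ I) = base I
  ∑Cut-image≡ (suc N) r (false ∷ e) I = begin
    r ^ ∣ e ∣ * ∑[ a < r ] #I                   ≡⟨ cong (r ^ ∣ e ∣ *_) (∑-const r #I) ⟩
    r ^ ∣ e ∣ * (r * #I)                        ≡⟨ x∙yz≈y∙xz (r ^ ∣ e ∣) r #I ⟩
    r * (r ^ ∣ e ∣ * #I)                        ≡⟨ cong (r *_) (∑Cut-image≡ N r e I) ⟩
    r * (r ^ N * surjections ∣ e ∣ ∣ I ∣)       ≡⟨ *-assoc r (r ^ N) _ ⟨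
    r ^ suc N * surjections ∣ e ∣ ∣ I ∣         ∎
    where
    open ≡-Reasoning
    #I : ℕ
    #I = ∑Cut N r (λ h → 𝟙 (does (image h e ≟ˢ I)))
  ∑Cut-image≡ (suc N) r (true ∷ e) I = begin
    r ^ suc ∣ e ∣ * ∑[ a < r ] ∑Cut N r (λ h → 𝟙 (does (⁅ a ⁆ ∪ image h e ≟ˢ I)))
      ≡⟨ cong (r ^ suc ∣ e ∣ *_) (sum-cong-≗ split) ⟩
    r ^ suc ∣ e ∣ * ∑[ a < r ] (𝟙 (does (a ∈? I)) * (#J I + #J (I - a)))
      ≡⟨ *-assoc r (r ^ ∣ e ∣) _ ⟩
    r * (r ^ ∣ e ∣ * ∑[ a < r ] (𝟙 (does (a ∈? I)) * (#J I + #J (I - a))))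
      ≡⟨ cong (r *_) (*-distribˡ-sum (r ^ ∣ e ∣) (λ a → 𝟙 (does (a ∈? I)) * (#J I + #J (I - a)))) ⟩
    r * ∑[ a < r ] (r ^ ∣ e ∣ * (𝟙 (does (a ∈? I)) * (#J I + #J (I - a))))
      ≡⟨ cong (r *_) (sum-cong-≗ (λ a → x∙yz≈y∙xz (r ^ ∣ e ∣) (𝟙 (does (a ∈? I))) _)) ⟩
    r * ∑[ a < r ] (𝟙 (does (a ∈? I)) * (r ^ ∣ e ∣ * (#J I + #J (I - a))))
      ≡⟨ cong (r *_) (∑-∈-const I _ _ removing) ⟩
    r * (∣ I ∣ * (r ^ N * (surjections ∣ e ∣ ∣ I ∣) + r ^ N * (surjections ∣ e ∣ (pred ∣ I ∣))))
      ≡⟨ cong (r *_) (trans (x∙yz≈y∙xz (r ^ N) ∣ I ∣ _) (cong (∣ I ∣ *_) (*-distribˡ-+ (r ^ N) _ _))) ⟨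
    r * (r ^ N * (surjections (suc ∣ e ∣) ∣ I ∣))
      ≡⟨ *-assoc r (r ^ N) _ ⟨
    r ^ suc N * surjections (suc ∣ e ∣) ∣ I ∣ ∎
    where
    open ≡-Reasoning
    #J : Subset r → ℕ
    #J J = ∑Cut N r (λ h → 𝟙 (does (image h e ≟ˢ J)))
    split : ∀ a → ∑Cut N r (λ h → 𝟙 (does (⁅ a ⁆ ∪ image h e ≟ˢ I))) ≡ 𝟙 (does (a ∈? I)) * (#J I + #J (I - a))
    split a = begin
      ∑Cut N r (λ h → 𝟙 (does (⁅ a ⁆ ∪ image h e ≟ˢ I)))
        ≡⟨ ∑Cut-cong r N (λ h → 𝟙[⁅a⁆∪J≡I] a (image h e) I) ⟩
      ∑Cut N r (λ h → 𝟙 (does (a ∈? I)) * (𝟙 (does (image h e ≟ˢ I)) + 𝟙 (does (image h e ≟ˢ I - a))))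
        ≡⟨ *-distribˡ-∑Cut r N (𝟙 (does (a ∈? I))) _ ⟨
      𝟙 (does (a ∈? I)) * ∑Cut N r (λ h → 𝟙 (does (image h e ≟ˢ I)) + 𝟙 (does (image h e ≟ˢ I - a)))
        ≡⟨ cong (𝟙 (does (a ∈? I)) *_) (∑Cut-distrib-+ r N _ _) ⟩
      𝟙 (does (a ∈? I)) * (#J I + #J (I - a)) ∎
    removing : ∀ {a} → a ∈ I →
      r ^ ∣ e ∣ * (#J I + #J (I - a)) ≡ r ^ N * (surjections ∣ e ∣ ∣ I ∣) + r ^ N * (surjections ∣ e ∣ (pred ∣ I ∣))
    removing {a} a∈I = begin
      r ^ ∣ e ∣ * (#J I + #J (I - a))
        ≡⟨ *-distribˡ-+ (r ^ ∣ e ∣) (#J I) (#J (I - a)) ⟩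
      r ^ ∣ e ∣ * #J I + r ^ ∣ e ∣ * #J (I - a)
        ≡⟨ cong₂ _+_ (∑Cut-image≡ N r e I) (∑Cut-image≡ N r e (I - a)) ⟩
      r ^ N * (surjections ∣ e ∣ ∣ I ∣) + r ^ N * (surjections ∣ e ∣ ∣ (I - a) ∣)
        ≡⟨ cong (λ m → r ^ N * (surjections ∣ e ∣ ∣ I ∣) + r ^ N * (surjections ∣ e ∣ (pred m))) (∣p-x∣+1≡∣p∣ I a∈I) ⟩
      r ^ N * (surjections ∣ e ∣ ∣ I ∣) + r ^ N * (surjections ∣ e ∣ (pred ∣ I ∣)) ∎

  ∑Cut-χ : ∀ N r (e : Subset N) → r ^ ∣ e ∣ * ∑Cut N r (χ e) ≡ r ^ N * surjections ∣ e ∣ r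
  ∑Cut-χ N r e = trans (cong (r ^ ∣ e ∣ *_) (∑Cut-cong r N (χ≡𝟙[image≡⊤] e)))
    (trans (∑Cut-image≡ N r e ⊤) (cong (λ m → r ^ N * surjections ∣ e ∣ m) (∣⊤∣≡n r)))

  Agrees : ∀ {N r} → Cut N r → Cut N r → Subset N → Set
  Agrees h π e = ∀ v → v ∈ e → h v ≡ π v

  agrees? : ∀ {N r} (h π : Cut N r) e → Dec (Agrees h π e)
  agrees? h π e = all? λ v → (v ∈? e) →-dec (h v ≟ π v)

  ∑Cut-agrees : ∀ N r (π : Cut N r) (e : Subset N) →
    r ^ ∣ e ∣ * ∑Cut N r (λ h → 𝟙 (does (agrees? h π e))) ≡ r ^ N
  ∑Cut-agrees zero    r π []          = refl
  ∑Cut-agrees (suc N) r π (false ∷ e) = begin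
    r ^ ∣ e ∣ * ∑[ a < r ] ∑Cut N r (λ h → 𝟙 (does (agrees? (a ◂ h) π (false ∷ e))))
      ≡⟨ cong (r ^ ∣ e ∣ *_) (sum-cong-≗ skip) ⟩
    r ^ ∣ e ∣ * ∑[ a < r ] #agree
      ≡⟨ cong (r ^ ∣ e ∣ *_) (∑-const r #agree) ⟩
    r ^ ∣ e ∣ * (r * #agree)
      ≡⟨ x∙yz≈y∙xz (r ^ ∣ e ∣) r #agree ⟩
    r * (r ^ ∣ e ∣ * #agree)
      ≡⟨ cong (r *_) (∑Cut-agrees N r (π ∘ suc) e) ⟩
    r ^ suc N ∎
    where
    open ≡-Reasoning
    #agree : ℕ
    #agree = ∑Cut N r (λ h → 𝟙 (does (agrees? h (π ∘ suc) e)))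
    skip : ∀ a → ∑Cut N r (λ h → 𝟙 (does (agrees? (a ◂ h) π (false ∷ e)))) ≡ #agree
    skip a = ∑Cut-cong r N λ h → 𝟙-does-cong (agrees? (a ◂ h) π (false ∷ e)) (agrees? h (π ∘ suc) e)
      (λ ag v v∈e → ag (suc v) (there v∈e)) (λ { ag (suc v) (there v∈e) → ag v v∈e })
  ∑Cut-agrees (suc N) r π (true ∷ e) = begin
    r ^ suc ∣ e ∣ * ∑[ a < r ] ∑Cut N r (λ h → 𝟙 (does (agrees? (a ◂ h) π (true ∷ e))))
      ≡⟨ cong (r ^ suc ∣ e ∣ *_) (sum-cong-≗ match-head) ⟩
    r ^ suc ∣ e ∣ * ∑[ a < r ] (𝟙 (does (a ≟ π zero)) * #agree)
      ≡⟨ cong (r ^ suc ∣ e ∣ *_) (∑-δ (π zero) #agree) ⟩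
    r ^ suc ∣ e ∣ * #agree
      ≡⟨ *-assoc r (r ^ ∣ e ∣) #agree ⟩
    r * (r ^ ∣ e ∣ * #agree)
      ≡⟨ cong (r *_) (∑Cut-agrees N r (π ∘ suc) e) ⟩
    r ^ suc N ∎
    where
    open ≡-Reasoning
    #agree : ℕ
    #agree = ∑Cut N r (λ h → 𝟙 (does (agrees? h (π ∘ suc) e)))
    split : ∀ a h → 𝟙 (does (agrees? (a ◂ h) π (true ∷ e)))
                  ≡ 𝟙 (does (a ≟ π zero)) * 𝟙 (does (agrees? h (π ∘ suc) e))
    split a h = trans (𝟙-does-cong (agrees? (a ◂ h) π (true ∷ e)) (a ≟ π zero ×-dec agrees? h (π ∘ suc) e)
      (λ ag → ag zero here , λ v v∈e → ag (suc v) (there v∈e))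
      (λ { (a≡π0 , ag) zero here → a≡π0 ; (a≡π0 , ag) (suc v) (there v∈e) → ag v v∈e }))
      (𝟙-×-dec (a ≟ π zero) (agrees? h (π ∘ suc) e))
    match-head : ∀ a → ∑Cut N r (λ h → 𝟙 (does (agrees? (a ◂ h) π (true ∷ e)))) ≡ 𝟙 (does (a ≟ π zero)) * #agree
    match-head a = trans (∑Cut-cong r N (split a))
      (sym (*-distribˡ-∑Cut r N (𝟙 (does (a ≟ π zero))) (λ h → 𝟙 (does (agrees? h (π ∘ suc) e)))))

  -- Recolouring a vertex

  module Colours (r0 : ℕ) where

    R : ℕ
    R = suc (suc r0)

    σ : Fin R → Fin R
    σ = transpose zero (suc zero)

    τ : Fin R → Fin R → Fin R
    τ a = id [ a ]≔ σ a

    τ-same : ∀ a → τ a a ≡ σ a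
    τ-same a = updateAt-updates a id

    τ-other : ∀ {a b} → b ≢ a → τ a b ≡ b
    τ-other {a} {b} b≢a = updateAt-minimal b a id b≢a

    ∑∑τ : ∀ (φ : Fin R → ℕ) → ∑[ a < R ] ∑[ b < R ] φ (τ a b) ≡ R * sum φ
    ∑∑τ φ = +-cancelʳ-≡ (sum φ) _ _ (begin
      ∑[ a < R ] ∑[ b < R ] φ (τ a b) + sum φ
        ≡⟨ ∑-distrib-+ (λ a → ∑[ b < R ] φ (τ a b)) φ ⟨
      ∑[ a < R ] (∑[ b < R ] φ (τ a b) + φ a)
        ≡⟨ sum-cong-≗ (λ a → trans (cong (_+ φ a) (sum-cong-≗ (φ∘τ≗ a))) (∑-updateAt φ a (φ (σ a)))) ⟩
      ∑[ a < R ] (sum φ + φ (σ a))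
        ≡⟨ ∑-distrib-+ (const (sum φ)) (φ ∘ σ) ⟩
      ∑[ a < R ] sum φ + ∑[ a < R ] φ (σ a)
        ≡⟨ cong₂ _+_ (∑-const R (sum φ)) (sym (∑-permute φ (Perm.transpose zero (suc zero)))) ⟩
      R * sum φ + sum φ ∎)
      where
      open ≡-Reasoning
      φ∘τ≗ : ∀ a b → φ (τ a b) ≡ (φ [ a ]≔ φ (σ a)) b
      φ∘τ≗ a b with b ≟ a
      ... | yes refl = trans (cong φ (τ-same b)) (sym (updateAt-updates b φ))
      ... | no  b≢a  = trans (cong φ (τ-other b≢a)) (sym (updateAt-minimal b a φ b≢a))

    -- Averaged over the colour a of u, b ↦ τ a b hits every colour equally often (∑∑τ), so the
    -- recoloured x is again uniform, provided G does not look at u.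
    ∑Cut-recolour : ∀ {N} {x u : Fin N} (G : Cut N R → ℕ) → Extensional G → u ≢ x →
      (∀ h a → G (h [ u ]≔ a) ≡ G h) →
      ∑Cut N R (λ h → G (h [ x ]≔ τ (h u) (h x))) ≡ ∑Cut N R G
    ∑Cut-recolour {N} {x} {u} G ext u≢x ignores-u = *-cancelˡ-≡ _ _ R (*-cancelˡ-≡ _ _ R (begin
      R * (R * ∑Cut N R Φ)
        ≡⟨ cong (R *_) (∑Cut-updateAt R N x Φ Φ-ext) ⟨
      R * ∑Cut N R (λ h → ∑[ b < R ] Φ (h [ x ]≔ b))
        ≡⟨ ∑Cut-updateAt R N u (λ h → ∑[ b < R ] Φ (h [ x ]≔ b)) (λ h≗h' → sum-cong-≗ (λ b → Φ-ext ([]≔-congˡ h≗h' x b))) ⟨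
      ∑Cut N R (λ h → ∑[ a < R ] ∑[ b < R ] Φ (h [ u ]≔ a [ x ]≔ b))
        ≡⟨ ∑Cut-cong R N (λ h → sum-cong-≗ (λ a → sum-cong-≗ (λ b → Φ[u≔a,x≔b] h a b))) ⟩
      ∑Cut N R (λ h → ∑[ a < R ] ∑[ b < R ] G (h [ x ]≔ τ a b))
        ≡⟨ ∑Cut-cong R N (λ h → ∑∑τ (λ c → G (h [ x ]≔ c))) ⟩
      ∑Cut N R (λ h → R * ∑[ c < R ] G (h [ x ]≔ c))
        ≡⟨ *-distribˡ-∑Cut R N R _ ⟨
      R * ∑Cut N R (λ h → ∑[ c < R ] G (h [ x ]≔ c))
        ≡⟨ cong (R *_) (∑Cut-updateAt R N x G ext) ⟩
      R * (R * ∑Cut N R G) ∎))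
      where
      open ≡-Reasoning
      Φ : Cut N R → ℕ
      Φ h = G (h [ x ]≔ τ (h u) (h x))
      Φ-ext : Extensional Φ
      Φ-ext {h} {h'} h≗h' = ext (λ y → trans ([]≔-congˡ h≗h' x _ y) (cong (λ c → (h' [ x ]≔ c) y) (cong₂ τ (h≗h' u) (h≗h' x))))
      Φ[u≔a,x≔b] : ∀ h a b → Φ (h [ u ]≔ a [ x ]≔ b) ≡ G (h [ x ]≔ τ a b)
      Φ[u≔a,x≔b] h a b = trans (ext reorder) (ignores-u (h [ x ]≔ τ a b) a)
        where
        g : Cut N R
        g = h [ u ]≔ a [ x ]≔ b
        g-u : g u ≡ a
        g-u = trans (updateAt-minimal u x _ u≢x) (updateAt-updates u h)
        reorder : g [ x ]≔ τ (g u) (g x) ≗ h [ x ]≔ τ a b [ u ]≔ a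
        reorder y = begin
          (g [ x ]≔ τ (g u) (g x)) y  ≡⟨ cong (λ c → (g [ x ]≔ c) y) (cong₂ τ g-u (updateAt-updates x _)) ⟩
          (g [ x ]≔ τ a b) y          ≡⟨ updateAt-updateAt x (h [ u ]≔ a) y ⟩
          (h [ u ]≔ a [ x ]≔ τ a b) y ≡⟨ updateAt-commutes x u (u≢x ∘ sym) h y ⟩
          (h [ x ]≔ τ a b [ u ]≔ a) y ∎

  -- Switching along a matching

  HasMatchedPair : ∀ {N} → (Fin N → Maybe (Fin N)) → Subset N → Set
  HasMatchedPair μ e = ∃ λ x → ∃ λ u → μ x ≡ just u × x ∈ e × u ∈ e

  hasMatchedPair? : ∀ {N} (μ : Fin N → Maybe (Fin N)) e → Dec (HasMatchedPair μ e)
  hasMatchedPair? μ e = map′ (λ { (x , x∈e , u , μx≡u , u∈e) → x , u , μx≡u , x∈e , u∈e })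
                             (λ { (x , u , μx≡u , x∈e , u∈e) → x , x∈e , u , μx≡u , u∈e })
                             (any? λ x → (x ∈? e) ×-dec partnerIn? x)
    where
    partnerIn? : ∀ x → Dec (∃ λ u → μ x ≡ just u × u ∈ e)
    partnerIn? x with μ x
    ... | nothing = no λ ()
    ... | just u  = map′ (λ u∈e → u , refl , u∈e) (λ { (_ , refl , u∈e) → u∈e }) (u ∈? e)

  matchedEdgeCount : ∀ {N} → (Fin N → Maybe (Fin N)) → MultiHypergraph N → ℕ
  matchedEdgeCount μ H = length (filter (hasMatchedPair? μ) H)

  record Matching {N} (μ : Fin N → Maybe (Fin N)) : Set where
    field
      partner-unmatched : ∀ {x u} → μ x ≡ just u → μ u ≡ nothing
      partner-injective : ∀ {x y u} → μ x ≡ just u → μ y ≡ just u → x ≡ y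

    partner≢self : ∀ {x u} → μ x ≡ just u → u ≢ x
    partner≢self μx≡u refl with () ← trans (sym μx≡u) (partner-unmatched μx≡u)

  module Switching (r0 : ℕ) {N} {μ : Fin N → Maybe (Fin N)} (matching : Matching μ) where

    open Colours r0
    open Matching matching
    open import Data.List.Membership.DecPropositional (_≟_ {N}) using () renaming (_∈?_ to _∈ᴸ?_)

    recolour : Bool → Maybe (Fin N) → Cut N R → Fin R → Fin R
    recolour true  (just u) h c = τ (h u) c
    recolour true  nothing  h c = c
    recolour false _        h c = c

    switch : (Fin N → Bool) → Cut N R → Cut N R
    switch A h y = recolour (A y) (μ y) h (h y)

    ｛_｝ : Fin N → Fin N → Bool
    ｛ x ｝ y = does (y ≟ x)

    _∪｛_｝ : (Fin N → Bool) → Fin N → Fin N → Bool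
    (A ∪｛ x ｝) y = A y ∨ does (y ≟ x)

    recolour-cong : ∀ b m {h h' : Cut N R} c → (∀ {u} → m ≡ just u → b ≡ true → h u ≡ h' u) →
      recolour b m h c ≡ recolour b m h' c
    recolour-cong true  (just u) c h≡h' = cong (λ a → τ a c) (h≡h' refl refl)
    recolour-cong true  nothing  c h≡h' = refl
    recolour-cong false m        c h≡h' = refl

    switch-unmatched : ∀ A h {y} → μ y ≡ nothing → switch A h y ≡ h y
    switch-unmatched A h {y} μy≡nothing rewrite μy≡nothing with A y
    ... | true  = refl
    ... | false = refl

    switch-inactive : ∀ A h {y} → A y ≡ false → switch A h y ≡ h y
    switch-inactive A h {y} Ay≡false rewrite Ay≡false = refl

    switch-congʳ : ∀ A {h h'} → h ≗ h' → switch A h ≗ switch A h'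
    switch-congʳ A {h} {h'} h≗h' y =
      trans (cong (recolour (A y) (μ y) h) (h≗h' y)) (recolour-cong (A y) (μ y) (h' y) (λ {u} _ _ → h≗h' u))

    switch-congˡ : ∀ {A A'} h → A ≗ A' → switch A h ≗ switch A' h
    switch-congˡ h A≗A' y = cong (λ b → recolour b (μ y) h (h y)) (A≗A' y)

    switch-｛｝ : ∀ {x u} h → μ x ≡ just u → switch ｛ x ｝ h ≗ h [ x ]≔ τ (h u) (h x)
    switch-｛｝ {x} h μx≡u y with y ≟ x
    ... | yes refl rewrite μx≡u = sym (updateAt-updates y h)
    ... | no  y≢x  = sym (updateAt-minimal y x h y≢x)

    switch-｛｝-other : ∀ {x y} h → y ≢ x → switch ｛ x ｝ h y ≡ h y
    switch-｛｝-other {x} {y} h y≢x with y ≟ x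
    ... | yes y≡x = contradiction y≡x y≢x
    ... | no  _   = refl

    switch-｛｝-unmatched : ∀ {x} h → μ x ≡ nothing → switch ｛ x ｝ h ≗ h
    switch-｛｝-unmatched {x} h μx≡nothing y with y ≟ x
    ... | yes refl rewrite μx≡nothing = refl
    ... | no  _    = refl

    switch-∪｛｝-last : ∀ A {x} h → A x ≡ false → switch (A ∪｛ x ｝) h ≗ switch ｛ x ｝ (switch A h)
    switch-∪｛｝-last A {x} h Ax≡false y with y ≟ x
    switch-∪｛｝-last A h Ax≡false y | yes refl rewrite Ax≡false with μ y in μy
    ... | nothing = refl
    ... | just u  = cong (λ a → τ a (h y)) (sym (switch-unmatched A h (partner-unmatched μy)))
    switch-∪｛｝-last A h Ax≡false y | no _ rewrite ∨-identityʳ (A y) = refl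

    switch-∪｛｝-first : ∀ A {x} h → A x ≡ false → switch (A ∪｛ x ｝) h ≗ switch A (switch ｛ x ｝ h)
    switch-∪｛｝-first A {x} h Ax≡false y with y ≟ x
    switch-∪｛｝-first A h Ax≡false y | yes refl rewrite Ax≡false with μ y
    ... | nothing = refl
    ... | just u  = refl
    switch-∪｛｝-first A {x} h Ax≡false y | no _ rewrite ∨-identityʳ (A y) with A y | μ y in μy
    ... | false | _       = refl
    ... | true  | nothing = refl
    ... | true  | just u  = cong (λ a → τ a (h y)) (sym (switch-unmatched ｛ x ｝ h (partner-unmatched μy)))

    switch-[]≔-partner : ∀ A {x u} h a → A x ≡ false → μ x ≡ just u →
      switch A (h [ u ]≔ a) ≗ switch A h [ u ]≔ a
    switch-[]≔-partner A {x} {u} h a Ax≡false μx≡u y with y ≟ u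
    ... | yes refl = begin
      switch A (h [ y ]≔ a) y ≡⟨ switch-unmatched A _ (partner-unmatched μx≡u) ⟩
      (h [ y ]≔ a) y          ≡⟨ updateAt-updates y h ⟩
      a                       ≡⟨ updateAt-updates y (switch A h) ⟨
      (switch A h [ y ]≔ a) y ∎
      where open ≡-Reasoning
    ... | no  y≢u  = begin
      switch A (h [ u ]≔ a) y             ≡⟨ cong (recolour (A y) (μ y) (h [ u ]≔ a)) (updateAt-minimal y u h y≢u) ⟩
      recolour (A y) (μ y) (h [ u ]≔ a) (h y) ≡⟨ recolour-cong (A y) (μ y) (h y) partner-untouched ⟩
      switch A h y                        ≡⟨ updateAt-minimal y u (switch A h) y≢u ⟨
      (switch A h [ u ]≔ a) y             ∎
      where
      open ≡-Reasoning
      partner-untouched : ∀ {v} → μ y ≡ just v → A y ≡ true → (h [ u ]≔ a) v ≡ h v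
      partner-untouched {v} μy≡v Ay≡true = updateAt-minimal v u h λ { refl →
        contradiction (trans (sym Ay≡true) (trans (cong A (partner-injective μy≡v μx≡u)) Ax≡false)) λ () }

    switch-｛｝-covers : ∀ {e x u} g → μ x ≡ just u → u ∈ e → Covers g e → Covers (switch ｛ x ｝ g) e
    switch-｛｝-covers {e} {x} {u} g μx≡u u∈e cov i with cov i
    ... | v , v∈e , gv≡i with v ≟ x
    ...   | no  v≢x = v , v∈e , trans (switch-｛｝-other g v≢x) gv≡i
    ...   | yes refl with g u ≟ g v
    ...     | yes gu≡gv = u , u∈e , trans (switch-｛｝-other g (partner≢self μx≡u)) (trans gu≡gv gv≡i)
    ...     | no  gu≢gv = v , v∈e , (begin
      switch ｛ v ｝ g v            ≡⟨ switch-｛｝ g μx≡u v ⟩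
      (g [ v ]≔ τ (g u) (g v)) v   ≡⟨ updateAt-updates v g ⟩
      τ (g u) (g v)                ≡⟨ τ-other (gu≢gv ∘ sym) ⟩
      g v                          ≡⟨ gv≡i ⟩
      i                            ∎)
      where open ≡-Reasoning

    ∑χ-switch≤switch-∪｛｝ : ∀ e A {x} → A x ≡ false → ∑Cut N R (χ e ∘ switch A) ≤ ∑Cut N R (χ e ∘ switch (A ∪｛ x ｝))
    ∑χ-switch≤switch-∪｛｝ e A {x} Ax≡false with μ x in μx
    ... | nothing = ≤-reflexive (∑Cut-cong R N λ h → χ-ext e λ y →
            sym (trans (switch-∪｛｝-last A h Ax≡false y) (switch-｛｝-unmatched (switch A h) μx y)))
    ... | just u with u ∈? e | x ∈? e
    ...   | no u∉e | _ = ≤-reflexive (sym (begin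
      ∑Cut N R (χ e ∘ switch (A ∪｛ x ｝))
        ≡⟨ ∑Cut-cong R N (λ h → χ-ext e (λ y → trans (switch-∪｛｝-first A h Ax≡false y) (switch-congʳ A (switch-｛｝ h μx) y))) ⟩
      ∑Cut N R (λ h → χ e (switch A (h [ x ]≔ τ (h u) (h x))))
        ≡⟨ ∑Cut-recolour (χ e ∘ switch A) (χ-ext e ∘ switch-congʳ A) (partner≢self μx) ignores-u ⟩
      ∑Cut N R (χ e ∘ switch A) ∎))
      where
      open ≡-Reasoning
      ignores-u : ∀ h a → χ e (switch A (h [ u ]≔ a)) ≡ χ e (switch A h)
      ignores-u h a = trans (χ-ext e (switch-[]≔-partner A h a Ax≡false μx))
        (χ-local e (λ {v} v∈e → updateAt-minimal v u (switch A h) λ { refl → u∉e v∈e }))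
    ...   | yes u∈e | no x∉e = ∑Cut-mono-≤ R N λ h → ≤-reflexive (sym (begin
      χ e (switch (A ∪｛ x ｝) h)         ≡⟨ χ-ext e (switch-∪｛｝-last A h Ax≡false) ⟩
      χ e (switch ｛ x ｝ (switch A h))   ≡⟨ χ-local e (λ {v} v∈e → switch-｛｝-other (switch A h) λ { refl → x∉e v∈e }) ⟩
      χ e (switch A h)                   ∎))
      where open ≡-Reasoning
    ...   | yes u∈e | yes _ = ∑Cut-mono-≤ R N λ h → ≤-trans
      (χ-mono e (switch-｛｝-covers (switch A h) μx u∈e))
      (≤-reflexive (χ-ext e (sym ∘ switch-∪｛｝-last A h Ax≡false)))

    _∪ᴸ_ : (Fin N → Bool) → List (Fin N) → Fin N → Bool
    (A ∪ᴸ L) y = A y ∨ does (y ∈ᴸ? L)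

    ∑χ-switch≤switch-∪ᴸ : ∀ e A L → ∑Cut N R (χ e ∘ switch A) ≤ ∑Cut N R (χ e ∘ switch (A ∪ᴸ L))
    ∑χ-switch≤switch-∪ᴸ e A [] = ≤-reflexive (∑Cut-cong R N λ h → χ-ext e (switch-congˡ h (sym ∘ ∨-identityʳ ∘ A)))
    ∑χ-switch≤switch-∪ᴸ e A (x ∷ L) with (A ∪ᴸ L) x in x∈A∪L
    ... | false = ≤-trans (∑χ-switch≤switch-∪ᴸ e A L) (≤-trans (∑χ-switch≤switch-∪｛｝ e (A ∪ᴸ L) x∈A∪L)
        (≤-reflexive (∑Cut-cong R N λ h → χ-ext e (switch-congˡ h reassociate))))
      where
      reassociate : ∀ y → ((A ∪ᴸ L) ∪｛ x ｝) y ≡ (A ∪ᴸ (x ∷ L)) y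
      reassociate y = trans (∨-assoc (A y) _ _) (cong (A y ∨_) (∨-comm (does (y ∈ᴸ? L)) _))
    ... | true = ≤-trans (∑χ-switch≤switch-∪ᴸ e A L) (≤-reflexive (∑Cut-cong R N λ h → χ-ext e (switch-congˡ h unchanged)))
      where
      unchanged : ∀ y → (A ∪ᴸ L) y ≡ (A ∪ᴸ (x ∷ L)) y
      unchanged y with y ≟ x
      ... | yes refl = trans x∈A∪L (sym (∨-zeroʳ (A y)))
      ... | no  _    = refl

    switchAll : Cut N R → Cut N R
    switchAll = switch (const true)

    ∑χ-switch≤switchAll : ∀ e A → ∑Cut N R (χ e ∘ switch A) ≤ ∑Cut N R (χ e ∘ switchAll)
    ∑χ-switch≤switchAll e A = ≤-trans (∑χ-switch≤switch-∪ᴸ e A (allFin N))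
      (≤-reflexive (∑Cut-cong R N λ h → χ-ext e (switch-congˡ h all-active)))
      where
      all-active : ∀ y → (A ∪ᴸ allFin N) y ≡ true
      all-active y = trans (cong (A y ∨_) (dec-true (y ∈ᴸ? allFin N) (∈-allFin y))) (∨-zeroʳ (A y))

    ∑χ≤switchAll : ∀ e → ∑Cut N R (χ e) ≤ ∑Cut N R (χ e ∘ switchAll)
    ∑χ≤switchAll e = ≤-trans (≤-reflexive (∑Cut-cong R N λ h → χ-ext e λ y → sym (switch-inactive (const false) h refl)))
      (∑χ-switch≤switchAll e (const false))

    module _ {e : Subset N} {x u : Fin N} (μx≡u : μ x ≡ just u) (u∈e : u ∈ e) (x∈e : x ∈ e) (R≤∣e∣ : R ≤ ∣ e ∣) where

      private
        rest : Subset N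
        rest = e - u - x

        r0≤∣rest∣ : r0 ≤ ∣ rest ∣
        r0≤∣rest∣ = ≤-pred (≤-pred (subst (R ≤_) (sym ∣e∣≡) R≤∣e∣))
          where
          ∣e∣≡ : suc (suc ∣ rest ∣) ≡ ∣ e ∣
          ∣e∣≡ = trans (cong suc (∣p-x∣+1≡∣p∣ (e - u) (x∈p∧x≢y⇒x∈p-y x∈e (partner≢self μx≡u ∘ sym))))
                       (∣p-x∣+1≡∣p∣ e u∈e)

        colour : ℕ → Fin R
        colour t with t <? r0
        ... | yes t<r0 = suc (suc (fromℕ< t<r0))
        ... | no  _    = zero

        colour≢1 : ∀ t → colour t ≢ suc zero
        colour≢1 t with t <? r0
        ... | yes _ = λ ()
        ... | no  _ = λ ()

        colour-toℕ : ∀ (j : Fin r0) → colour (toℕ j) ≡ suc (suc j)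
        colour-toℕ j with toℕ j <? r0
        ... | yes j<r0 = cong (λ k → suc (suc k)) (fromℕ<-toℕ j j<r0)
        ... | no  j≮r0 = contradiction (toℕ<n j) j≮r0

        π : Cut N R
        π w with w ∈? rest
        ... | yes _ = colour (rank rest w)
        ... | no  _ = zero

        π≢1 : ∀ w → π w ≢ suc zero
        π≢1 w with w ∈? rest
        ... | yes _ = colour≢1 (rank rest w)
        ... | no  _ = λ ()

        π-outside : ∀ {w} → w ∉ rest → π w ≡ zero
        π-outside {w} w∉rest with w ∈? rest
        ... | yes w∈rest = contradiction w∈rest w∉rest
        ... | no  _      = refl

        π-u : π u ≡ zero
        π-u = π-outside (λ u∈rest → x∈p-y⇒x≢y e (p─q⊆p (e - u) ⁅ x ⁆ u∈rest) refl)

        π-x : π x ≡ zero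
        π-x = π-outside (λ x∈rest → x∈p-y⇒x≢y (e - u) x∈rest refl)

        π-hits : ∀ i → i ≢ suc zero → ∃ λ w → w ∈ e × w ≢ x × π w ≡ i
        π-hits zero          _   = u , u∈e , partner≢self μx≡u , π-u
        π-hits (suc zero)    i≢1 = contradiction refl i≢1
        π-hits (suc (suc j)) _   with rank-surjective rest (≤-trans (toℕ<n j) r0≤∣rest∣)
        ... | w , w∈rest , rank≡j = w , p─q⊆p e ⁅ u ⁆ (p─q⊆p (e - u) ⁅ x ⁆ w∈rest) , x∈p-y⇒x≢y (e - u) w∈rest , πw
          where
          πw : π w ≡ suc (suc j)
          πw with w ∈? rest
          ... | yes _        = trans (cong colour rank≡j) (colour-toℕ j)
          ... | no  w∉rest   = contradiction w∈rest w∉rest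

        agreeing-uncut : ∀ h → Agrees h π e → χ e h ≡ 0
        agreeing-uncut h ag = χ≡0 e λ cov → case cov (suc zero) of λ where
          (v , v∈e , hv≡1) → π≢1 v (trans (sym (ag v v∈e)) hv≡1)

        agreeing-switched-cut : ∀ h → Agrees h π e → χ e (switch ｛ x ｝ h) ≡ 1
        agreeing-switched-cut h ag = χ≡1 e covers
          where
          covers : Covers (switch ｛ x ｝ h) e
          covers i with i ≟ suc zero
          ... | yes refl = x , x∈e , (begin
            switch ｛ x ｝ h x           ≡⟨ switch-｛｝ h μx≡u x ⟩
            (h [ x ]≔ τ (h u) (h x)) x  ≡⟨ updateAt-updates x h ⟩
            τ (h u) (h x)               ≡⟨ cong₂ τ (trans (ag u u∈e) π-u) (trans (ag x x∈e) π-x) ⟩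
            τ zero zero                 ≡⟨ τ-same zero ⟩
            suc zero                    ∎)
            where open ≡-Reasoning
          ... | no  i≢1 with π-hits i i≢1
          ...   | w , w∈e , w≢x , πw≡i = w , w∈e , trans (switch-｛｝-other h w≢x) (trans (ag w w∈e) πw≡i)

      ∑χ-switch-｛｝-gain : R ^ ∣ e ∣ * ∑Cut N R (χ e) + R ^ N ≤ R ^ ∣ e ∣ * ∑Cut N R (χ e ∘ switch ｛ x ｝)
      ∑χ-switch-｛｝-gain = begin
        R ^ ∣ e ∣ * ∑Cut N R (χ e) + R ^ N
          ≡⟨ cong (R ^ ∣ e ∣ * ∑Cut N R (χ e) +_) (∑Cut-agrees N R π e) ⟨
        R ^ ∣ e ∣ * ∑Cut N R (χ e) + R ^ ∣ e ∣ * ∑Cut N R (λ h → 𝟙 (does (agrees? h π e)))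
          ≡⟨ *-distribˡ-+ (R ^ ∣ e ∣) _ _ ⟨
        R ^ ∣ e ∣ * (∑Cut N R (χ e) + ∑Cut N R (λ h → 𝟙 (does (agrees? h π e))))
          ≡⟨ cong (R ^ ∣ e ∣ *_) (∑Cut-distrib-+ R N (χ e) _) ⟨
        R ^ ∣ e ∣ * ∑Cut N R (λ h → χ e h + 𝟙 (does (agrees? h π e)))
          ≤⟨ *-monoʳ-≤ (R ^ ∣ e ∣) (∑Cut-mono-≤ R N pointwise) ⟩
        R ^ ∣ e ∣ * ∑Cut N R (χ e ∘ switch ｛ x ｝) ∎
        where
        open ≤-Reasoning
        pointwise : ∀ h → χ e h + 𝟙 (does (agrees? h π e)) ≤ χ e (switch ｛ x ｝ h)
        pointwise h with agrees? h π e
        ... | yes ag = ≤-reflexive (trans (cong₂ _+_ (agreeing-uncut h ag) (𝟙-does-yes (agrees? h π e) ag))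
                                          (sym (agreeing-switched-cut h ag)))
        ... | no ¬ag = ≤-trans (≤-reflexive (trans (cong (χ e h +_) (𝟙-does-no (agrees? h π e) ¬ag)) (+-identityʳ _)))
                               (χ-mono e (switch-｛｝-covers h μx≡u u∈e))

    ∑χ-switchAll≥ : ∀ e → R ≤ ∣ e ∣ →
      R ^ N * (surjections ∣ e ∣ R + 𝟙 (does (hasMatchedPair? μ e))) ≤ R ^ ∣ e ∣ * ∑Cut N R (χ e ∘ switchAll)
    ∑χ-switchAll≥ e R≤∣e∣ with hasMatchedPair? μ e
    ... | no ¬pair = begin
      R ^ N * (surjections ∣ e ∣ R + 𝟙 (does (hasMatchedPair? μ e)))
        ≡⟨ cong (λ m → R ^ N * (surjections ∣ e ∣ R + m)) (𝟙-does-no (hasMatchedPair? μ e) ¬pair) ⟩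
      R ^ N * (surjections ∣ e ∣ R + 0) ≡⟨ cong (R ^ N *_) (+-identityʳ _) ⟩
      R ^ N * surjections ∣ e ∣ R       ≡⟨ ∑Cut-χ N R e ⟨
      R ^ ∣ e ∣ * ∑Cut N R (χ e)        ≤⟨ *-monoʳ-≤ (R ^ ∣ e ∣) (∑χ≤switchAll e) ⟩
      R ^ ∣ e ∣ * ∑Cut N R (χ e ∘ switchAll) ∎
      where open ≤-Reasoning
    ... | yes pair@(x , u , μx≡u , x∈e , u∈e) = begin
      R ^ N * (surjections ∣ e ∣ R + 𝟙 (does (hasMatchedPair? μ e)))
        ≡⟨ cong (λ m → R ^ N * (surjections ∣ e ∣ R + m)) (𝟙-does-yes (hasMatchedPair? μ e) pair) ⟩
      R ^ N * (surjections ∣ e ∣ R + 1)          ≡⟨ *-distribˡ-+ (R ^ N) _ 1 ⟩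
      R ^ N * surjections ∣ e ∣ R + R ^ N * 1    ≡⟨ cong₂ _+_ (∑Cut-χ N R e) (sym (*-identityʳ (R ^ N))) ⟨
      R ^ ∣ e ∣ * ∑Cut N R (χ e) + R ^ N         ≤⟨ ∑χ-switch-｛｝-gain μx≡u u∈e x∈e R≤∣e∣ ⟩
      R ^ ∣ e ∣ * ∑Cut N R (χ e ∘ switch ｛ x ｝) ≤⟨ *-monoʳ-≤ (R ^ ∣ e ∣) (∑χ-switch≤switchAll e ｛ x ｝) ⟩
      R ^ ∣ e ∣ * ∑Cut N R (χ e ∘ switchAll)     ∎
      where open ≤-Reasoning

    ∑cutSize-switchAll≥ : ∀ k (H : MultiHypergraph N) → All (λ e → ∣ e ∣ ≡ k) H → R ≤ k →
      R ^ N * (surjections k R * length H + matchedEdgeCount μ H) ≤ R ^ k * ∑Cut N R (cutSize H ∘ switchAll)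
    ∑cutSize-switchAll≥ k [] [] R≤k =
      ≤-trans (≤-reflexive (trans (cong (λ m → R ^ N * (m + 0)) (*-zeroʳ (surjections k R))) (*-zeroʳ (R ^ N)))) z≤n
    ∑cutSize-switchAll≥ k (e ∷ H) (refl ∷ ∣H∣≡k) R≤k = begin
      R ^ N * (s * suc (length H) + matchedEdgeCount μ (e ∷ H))
        ≡⟨ cong (λ m → R ^ N * (s * suc (length H) + m)) (length-filter-∷ (hasMatchedPair? μ) e H) ⟩
      R ^ N * (s * suc (length H) + (m₀ + matchedEdgeCount μ H))
        ≡⟨ cong (R ^ N *_) (solve 4 (λ s l m₀ m → s :* (con 1 :+ l) :+ (m₀ :+ m) := (s :+ m₀) :+ (s :* l :+ m)) refl s (length H) m₀ (matchedEdgeCount μ H)) ⟩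
      R ^ N * ((s + m₀) + (s * length H + matchedEdgeCount μ H))
        ≡⟨ *-distribˡ-+ (R ^ N) _ _ ⟩
      R ^ N * (s + m₀) + R ^ N * (s * length H + matchedEdgeCount μ H)
        ≤⟨ +-mono-≤ (∑χ-switchAll≥ e R≤k) (∑cutSize-switchAll≥ ∣ e ∣ H ∣H∣≡k R≤k) ⟩
      R ^ ∣ e ∣ * ∑Cut N R (χ e ∘ switchAll) + R ^ ∣ e ∣ * ∑Cut N R (cutSize H ∘ switchAll)
        ≡⟨ *-distribˡ-+ (R ^ ∣ e ∣) _ _ ⟨
      R ^ ∣ e ∣ * (∑Cut N R (χ e ∘ switchAll) + ∑Cut N R (cutSize H ∘ switchAll))
        ≡⟨ cong (R ^ ∣ e ∣ *_) (∑Cut-distrib-+ R N (χ e ∘ switchAll) (cutSize H ∘ switchAll)) ⟨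
      R ^ ∣ e ∣ * ∑Cut N R (λ h → χ e (switchAll h) + cutSize H (switchAll h))
        ≡⟨ cong (R ^ ∣ e ∣ *_) (∑Cut-cong R N λ h → sym (length-filter-∷ (T? ∘ cutsEdge (switchAll h)) e H)) ⟩
      R ^ ∣ e ∣ * ∑Cut N R (cutSize (e ∷ H) ∘ switchAll) ∎
      where
      open ≤-Reasoning
      open +-*-Solver
      s m₀ : ℕ
      s  = surjections ∣ e ∣ R
      m₀ = 𝟙 (does (hasMatchedPair? μ e))

    ∃-cut≥ : ∀ k (H : MultiHypergraph N) → All (λ e → ∣ e ∣ ≡ k) H → R ≤ k →
      ∃ λ f → surjections k R * length H + matchedEdgeCount μ H ≤ R ^ k * cutSize H f
    ∃-cut≥ k H ∣H∣≡k R≤k with ∃-cut≥average N (suc r0) (cutSize H ∘ switchAll)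
    ... | h , ∑≤ = switchAll h , *-cancelˡ-≤ (R ^ N) {{m^n≢0 R N}} (begin
      R ^ N * (surjections k R * length H + matchedEdgeCount μ H)  ≤⟨ ∑cutSize-switchAll≥ k H ∣H∣≡k R≤k ⟩
      R ^ k * ∑Cut N R (cutSize H ∘ switchAll)           ≤⟨ *-monoʳ-≤ (R ^ k) ∑≤ ⟩
      R ^ k * (R ^ N * cutSize H (switchAll h))          ≡⟨ x∙yz≈y∙xz (R ^ k) (R ^ N) _ ⟩
      R ^ N * (R ^ k * cutSize H (switchAll h))          ∎)
      where open ≤-Reasoning

  -- Rank classes of W

  module RankClasses {N : ℕ} (W : Subset N) where

    InClass : ℕ → Fin N → Fin N → Set
    InClass c x y = x ∈ W × y ∈ W × toℕ y < toℕ x × rank W y + rank W x ≡ c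

    inClass? : ∀ c x y → Dec (InClass c x y)
    inClass? c x y = (x ∈? W) ×-dec (y ∈? W) ×-dec (toℕ y <? toℕ x) ×-dec (rank W y + rank W x ≟ℕ c)

    partner : ℕ → Fin N → Maybe (Fin N)
    partner c x with any? (inClass? c x)
    ... | yes (y , _) = just y
    ... | no  _       = nothing

    partner-sound : ∀ {c x y} → partner c x ≡ just y → InClass c x y
    partner-sound {c} {x} eq with any? (inClass? c x)
    partner-sound refl | yes (y , y∈c) = y∈c

    partner-complete : ∀ {c x y} → InClass c x y → ∃ λ y' → partner c x ≡ just y'
    partner-complete {c} {x} {y} y∈c with any? (inClass? c x)
    ... | yes (y' , _) = y' , refl
    ... | no  none     = contradiction (y , y∈c) none

    matching : ∀ c → Matching (partner c)
    matching c = record { partner-unmatched = unmatched ; partner-injective = injective }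
      where
      unmatched : ∀ {x u} → partner c x ≡ just u → partner c u ≡ nothing
      unmatched {x} {u} μx≡u with partner c u in μu
      ... | nothing = refl
      ... | just z with partner-sound μx≡u | partner-sound μu
      ...   | x∈W , _ , u<x , ru+rx≡c | _ , z∈W , z<u , rz+ru≡c =
        contradiction (+-cancelˡ-≡ (rank W u) _ _ (trans (+-comm (rank W u) (rank W z)) (trans rz+ru≡c (sym ru+rx≡c))))
                      (<⇒≢ (rank-strictMono W z∈W (<-trans z<u u<x)))
      injective : ∀ {x y u} → partner c x ≡ just u → partner c y ≡ just u → x ≡ y
      injective μx≡u μy≡u with partner-sound μx≡u | partner-sound μy≡u
      ... | x∈W , _ , _ , ru+rx≡c | y∈W , _ , _ , ru+ry≡c =
        rank-injective W x∈W y∈W (+-cancelˡ-≡ _ _ _ (trans ru+rx≡c (sym ru+ry≡c)))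

    partner-rank-sum : ∀ {u v} → u ∈ W → v ∈ W → toℕ u < toℕ v → partner (rank W u + rank W v) v ≡ just u
    partner-rank-sum {u} {v} u∈W v∈W u<v with partner-complete (v∈W , u∈W , u<v , refl)
    ... | y , μv≡y with partner-sound μv≡y
    ...   | _ , y∈W , _ , ry+rv≡ = trans μv≡y (cong just (rank-injective W y∈W u∈W (+-cancelʳ-≡ _ _ _ ry+rv≡)))

    isCliquePair : Subset N → Fin N × Fin N → Bool
    isCliquePair e (u , v) = does (u <ᶠ? v) ∧ (does (u ∈? e) ∧ does (v ∈? e))

    inW² : Fin N × Fin N → Bool
    inW² (u , v) = does (u ∈? W) ∧ does (v ∈? W)

    pairsIn : Subset N → ℕ
    pairsIn e = length (induced (cliquePairs e) W)

    pairsIn≡∑ : ∀ e → pairsIn e ≡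
      ∑[ u < N ] ∑[ v < N ] 𝟙 ((does (u <ᶠ? v) ∧ (does (u ∈? e) ∧ does (v ∈? e))) ∧ (does (u ∈? W) ∧ does (v ∈? W)))
    pairsIn≡∑ e = trans (cong length (filterᵇ-filterᵇ inW² (isCliquePair e) (cartesianProduct (allFin N) (allFin N))))
                        (length-filterᵇ-cartesianProduct (λ a → isCliquePair e a ∧ inW² a) id id)

    pairsIn≤ : ∀ e → pairsIn e ≤ ∣ e ∣ * ∣ e ∣
    pairsIn≤ e = begin
      pairsIn e
        ≡⟨ pairsIn≡∑ e ⟩
      ∑[ u < N ] ∑[ v < N ] 𝟙 ((does (u <ᶠ? v) ∧ (does (u ∈? e) ∧ does (v ∈? e))) ∧ (does (u ∈? W) ∧ does (v ∈? W)))
        ≤⟨ ∑-mono-≤ N (λ u → ∑-mono-≤ N (λ v → both-in-e u v)) ⟩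
      ∑[ u < N ] ∑[ v < N ] (𝟙 (does (u ∈? e)) * 𝟙 (does (v ∈? e)))
        ≡⟨ sum-cong-≗ (λ u → *-distribˡ-sum (𝟙 (does (u ∈? e))) (λ v → 𝟙 (does (v ∈? e)))) ⟨
      ∑[ u < N ] (𝟙 (does (u ∈? e)) * ∑[ v < N ] 𝟙 (does (v ∈? e)))
        ≡⟨ *-distribʳ-sum (∑[ v < N ] 𝟙 (does (v ∈? e))) (λ u → 𝟙 (does (u ∈? e))) ⟨
      (∑[ u < N ] 𝟙 (does (u ∈? e))) * (∑[ v < N ] 𝟙 (does (v ∈? e)))
        ≡⟨ cong₂ _*_ (∣p∣≡∑ e) (∣p∣≡∑ e) ⟨
      ∣ e ∣ * ∣ e ∣ ∎
      where
      open ≤-Reasoning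
      both-in-e : ∀ u v → 𝟙 ((does (u <ᶠ? v) ∧ (does (u ∈? e) ∧ does (v ∈? e))) ∧ (does (u ∈? W) ∧ does (v ∈? W)))
                        ≤ 𝟙 (does (u ∈? e)) * 𝟙 (does (v ∈? e))
      both-in-e u v = ≤-trans (𝟙-∧-≤ˡ (isCliquePair e (u , v)) (inW² (u , v)))
        (≤-trans (𝟙-∧-≤ʳ (does (u <ᶠ? v)) (does (u ∈? e) ∧ does (v ∈? e))) (≤-reflexive (𝟙-∧ (does (u ∈? e)) (does (v ∈? e)))))

    #classes : ℕ
    #classes = ∣ W ∣ + ∣ W ∣

    counted-pair : ∀ e u v → 0 < 𝟙 ((does (u <ᶠ? v) ∧ (does (u ∈? e) ∧ does (v ∈? e))) ∧ (does (u ∈? W) ∧ does (v ∈? W))) →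
      toℕ u < toℕ v × u ∈ e × v ∈ e × u ∈ W × v ∈ W
    counted-pair e u v with toℕ u <ᵇ toℕ v in u<ᵇv | u ∈? e | v ∈? e | u ∈? W | v ∈? W
    ... | true  | yes u∈e | yes v∈e | yes u∈W | yes v∈W = λ _ → <ᵇ⇒< (toℕ u) (toℕ v) (subst T (sym u<ᵇv) _) , u∈e , v∈e , u∈W , v∈W
    ... | false | _       | _       | _       | _       = λ ()
    ... | true  | no _    | _       | _       | _       = λ ()
    ... | true  | yes _   | no _    | _       | _       = λ ()
    ... | true  | yes _   | yes _   | no _    | _       = λ ()
    ... | true  | yes _   | yes _   | yes _   | no _    = λ ()

    pairsIn-positive : ∀ e → 0 < pairsIn e → ∃ λ c → c < #classes × HasMatchedPair (partner c) e
    pairsIn-positive e 0<pairs with ∑-positive _ (subst (0 <_) (pairsIn≡∑ e) 0<pairs)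
    ... | u , 0<∑ with ∑-positive _ 0<∑
    ...   | v , 0<𝟙 with counted-pair e u v 0<𝟙
    ...     | u<v , u∈e , v∈e , u∈W , v∈W =
      rank W u + rank W v , +-mono-< (rank<∣p∣ W u∈W) (rank<∣p∣ W v∈W) ,
      v , u , partner-rank-sum u∈W v∈W u<v , v∈e , u∈e

    pairsIn≤matched : ∀ e → pairsIn e ≤ ∣ e ∣ * ∣ e ∣ * ∑[ c < #classes ] 𝟙 (does (hasMatchedPair? (partner (toℕ c)) e))
    pairsIn≤matched e = ≤-from-positive (bound ∘ pairsIn-positive e)
      where
      open ≤-Reasoning
      matched : Fin #classes → ℕ
      matched c = 𝟙 (does (hasMatchedPair? (partner (toℕ c)) e))
      bound : (∃ λ c → c < #classes × HasMatchedPair (partner c) e) → pairsIn e ≤ ∣ e ∣ * ∣ e ∣ * sum matched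
      bound (c , c<#classes , pair) = begin
        pairsIn e                 ≤⟨ pairsIn≤ e ⟩
        ∣ e ∣ * ∣ e ∣             ≡⟨ *-identityʳ (∣ e ∣ * ∣ e ∣) ⟨
        ∣ e ∣ * ∣ e ∣ * 1         ≤⟨ *-monoʳ-≤ (∣ e ∣ * ∣ e ∣) (≤-trans (≤-reflexive (sym matched-c)) (term≤∑ matched (fromℕ< c<#classes))) ⟩
        ∣ e ∣ * ∣ e ∣ * sum matched ∎
        where
        matched-c : matched (fromℕ< c<#classes) ≡ 1
        matched-c = 𝟙-does-yes (hasMatchedPair? (partner (toℕ (fromℕ< c<#classes))) e)
          (subst (λ c → HasMatchedPair (partner c) e) (sym (toℕ-fromℕ< c<#classes)) pair)

    inducedEdgeCount≤ : ∀ k (H : MultiHypergraph N) → All (λ e → ∣ e ∣ ≡ k) H →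
      inducedEdgeCount H W ≤ k * k * ∑[ c < #classes ] matchedEdgeCount (partner (toℕ c)) H
    inducedEdgeCount≤ k []      []             = z≤n
    inducedEdgeCount≤ k (e ∷ H) (refl ∷ ∣H∣≡k) = begin
      inducedEdgeCount (e ∷ H) W
        ≡⟨ length-filter-++ (T? ∘ inW²) (cliquePairs e) (G H) ⟩
      pairsIn e + inducedEdgeCount H W
        ≤⟨ +-mono-≤ (pairsIn≤matched e) (inducedEdgeCount≤ ∣ e ∣ H ∣H∣≡k) ⟩
      k² * ∑[ c < #classes ] 𝟙 (matched c) + k² * ∑[ c < #classes ] matchedEdgeCount (partner (toℕ c)) H
        ≡⟨ *-distribˡ-+ k² _ _ ⟨
      k² * (∑[ c < #classes ] 𝟙 (matched c) + ∑[ c < #classes ] matchedEdgeCount (partner (toℕ c)) H)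
        ≡⟨ cong (k² *_) (∑-distrib-+ (λ c → 𝟙 (matched c)) (λ c → matchedEdgeCount (partner (toℕ c)) H)) ⟨
      k² * ∑[ c < #classes ] (𝟙 (matched c) + matchedEdgeCount (partner (toℕ c)) H)
        ≡⟨ cong (k² *_) (sum-cong-≗ matched-∷) ⟨
      k² * ∑[ c < #classes ] matchedEdgeCount (partner (toℕ c)) (e ∷ H) ∎
      where
      open ≤-Reasoning
      k² : ℕ
      k² = ∣ e ∣ * ∣ e ∣
      matched : Fin #classes → Bool
      matched c = does (hasMatchedPair? (partner (toℕ c)) e)
      matched-∷ : ∀ c → matchedEdgeCount (partner (toℕ c)) (e ∷ H) ≡ 𝟙 (matched c) + matchedEdgeCount (partner (toℕ c)) H
      matched-∷ c = length-filter-∷ (hasMatchedPair? (partner (toℕ c))) e H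

  ∃-cut-with-excess : ∀ r0 k → suc (suc r0) ≤ k → ∀ N (H : MultiHypergraph N) → All (λ e → ∣ e ∣ ≡ k) H →
    (W : Subset N) → 1 ≤ ∣ W ∣ → ∃ λ (f : Cut N (suc (suc r0))) → ∃ λ X →
      stirling2 k (suc (suc r0)) * (suc (suc r0)) ! * length H + X ≤ suc (suc r0) ^ k * cutSize H f ×
      inducedEdgeCount H W ≤ k * k * 2 * ∣ W ∣ * X
  ∃-cut-with-excess r0 k R≤k N H ∣H∣≡k W 1≤∣W∣ =
    f , X , subst (λ B → B + X ≤ R ^ k * cutSize H f) B≡ surj+X≤ , M≤
    where
    open RankClasses W
    open Colours r0 using (R)
    open +-*-Solver
    X-of : Fin #classes → ℕ
    X-of c = matchedEdgeCount (partner (toℕ c)) H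
    best : ∃ λ c → sum X-of ≤ #classes * X-of c
    best = ∃-term≥average #classes {{>-nonZero (+-mono-≤ 1≤∣W∣ z≤n)}} X-of
    X : ℕ
    X = X-of (proj₁ best)
    cut : ∃ λ f → surjections k R * length H + X ≤ R ^ k * cutSize H f
    cut = Switching.∃-cut≥ r0 (matching (toℕ (proj₁ best))) k H ∣H∣≡k R≤k
    f : Cut N R
    f = proj₁ cut
    surj+X≤ : surjections k R * length H + X ≤ R ^ k * cutSize H f
    surj+X≤ = proj₂ cut
    B≡ : surjections k R * length H ≡ stirling2 k R * R ! * length H
    B≡ = cong (_* length H) (trans (surjections≡!*stirling2 k R) (*-comm (R !) (stirling2 k R)))
    M≤ : inducedEdgeCount H W ≤ k * k * 2 * ∣ W ∣ * X
    M≤ = begin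
      inducedEdgeCount H W                ≤⟨ inducedEdgeCount≤ k H ∣H∣≡k ⟩
      k * k * sum X-of                    ≤⟨ *-monoʳ-≤ (k * k) (proj₂ best) ⟩
      k * k * ((∣ W ∣ + ∣ W ∣) * X)         ≡⟨ solve 3 (λ k n x → k :* k :* ((n :+ n) :* x) := k :* k :* con 2 :* n :* x) refl k ∣ W ∣ X ⟩
      k * k * 2 * ∣ W ∣ * X                 ∎
      where open ≤-Reasoning

module _ where

  open import Data.Nat as ℕ using (suc; _∸_; z≤n; s≤s)
  import Data.Nat.Properties as ℕ
  open import Data.Nat.Solver using (module +-*-Solver)
  open import Data.Integer as ℤ using (+_)
  import Data.Integer.Properties as ℤ
  open import Data.Rational using (0ℚ; _≤_; _<_; _*_; _-_; -_; toℚᵘ)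
  open import Data.Rational.Properties
    using (toℚᵘ-cancel-≤; toℚᵘ-cancel-<; toℚᵘ-homo-*; toℚᵘ-homo-+; toℚᵘ-homo‿-; toℚᵘ-fromℚᵘ)
  open import Data.Rational.Unnormalised as U using (mkℚᵘ; *≤*; *<*)
  import Data.Rational.Unnormalised.Properties as U
  open import Relation.Binary.PropositionalEquality

  toℚᵘ-frac : ∀ a d → toℚᵘ (frac a (suc d)) U.≃ mkℚᵘ (+ a) d
  toℚᵘ-frac a d = toℚᵘ-fromℚᵘ (mkℚᵘ (+ a) d)

  0<frac : ∀ {a d} → 0 ℕ.< a → 0 ℕ.< d → 0ℚ < frac a d
  0<frac {suc a} {suc d} _ _ = toℚᵘ-cancel-< (U.<-respʳ-≃ (U.≃-sym (toℚᵘ-frac (suc a) d)) (*<* (ℤ.+<+ (s≤s z≤n))))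

  [1/KD]*[M/n]≤A-B/D : ∀ A B X M K D n → 0 ℕ.< K → 0 ℕ.< D → 0 ℕ.< n →
    B ℕ.+ X ℕ.≤ D ℕ.* A → M ℕ.≤ K ℕ.* n ℕ.* X →
    frac 1 (K ℕ.* D) * frac M n ≤ frac A 1 - frac B D
  [1/KD]*[M/n]≤A-B/D A B X M (suc K) (suc D) (suc n) _ _ _ B+X≤DA M≤KnX =
    toℚᵘ-cancel-≤ (U.≤-respˡ-≃ (U.≃-sym lhs≃) (U.≤-respʳ-≃ (U.≃-sym rhs≃) (*≤* cross)))
    where
    open +-*-Solver
    KD-1 : ℕ.ℕ
    KD-1 = D ℕ.+ K ℕ.* suc D
    lhs≃ : toℚᵘ (frac 1 (suc KD-1) * frac M (suc n)) U.≃ mkℚᵘ (+ 1) KD-1 U.* mkℚᵘ (+ M) n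
    lhs≃ = U.≃-trans (toℚᵘ-homo-* (frac 1 (suc KD-1)) (frac M (suc n))) (U.*-cong (toℚᵘ-frac 1 KD-1) (toℚᵘ-frac M n))
    rhs≃ : toℚᵘ (frac A 1 - frac B (suc D)) U.≃ mkℚᵘ (+ A) 0 U.+ U.- mkℚᵘ (+ B) D
    rhs≃ = U.≃-trans (toℚᵘ-homo-+ (frac A 1) (- frac B (suc D)))
             (U.+-cong (toℚᵘ-frac A 0) (U.≃-trans (toℚᵘ-homo‿- (frac B (suc D))) (U.-‿cong (toℚᵘ-frac B D))))
    B≤AD : B ℕ.≤ A ℕ.* suc D
    B≤AD = ℕ.≤-trans (ℕ.m≤m+n B X) (ℕ.≤-trans B+X≤DA (ℕ.≤-reflexive (ℕ.*-comm (suc D) A)))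
    X≤AD-B : X ℕ.≤ A ℕ.* suc D ∸ B
    X≤AD-B = ℕ.m+n≤o⇒m≤o∸n X (ℕ.≤-trans (ℕ.≤-reflexive (ℕ.+-comm X B)) (ℕ.≤-trans B+X≤DA (ℕ.≤-reflexive (ℕ.*-comm (suc D) A))))
    rhs-numerator : + A ℤ.* + suc D ℤ.+ (ℤ.- + B) ℤ.* + 1 ≡ + (A ℕ.* suc D ∸ B)
    rhs-numerator = begin
      + A ℤ.* + suc D ℤ.+ (ℤ.- + B) ℤ.* + 1 ≡⟨ cong₂ ℤ._+_ (sym (ℤ.pos-* A (suc D))) (ℤ.*-identityʳ (ℤ.- + B)) ⟩
      + (A ℕ.* suc D) ℤ.+ (ℤ.- + B)         ≡⟨ ℤ.m-n≡m⊖n (A ℕ.* suc D) B ⟩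
      (A ℕ.* suc D) ℤ.⊖ B                   ≡⟨ ℤ.⊖-≥ B≤AD ⟩
      + (A ℕ.* suc D ∸ B)                   ∎
      where open ≡-Reasoning
    cross-ℕ : M ℕ.* suc D ℕ.≤ (A ℕ.* suc D ∸ B) ℕ.* (suc KD-1 ℕ.* suc n)
    cross-ℕ = ℕ.≤-trans (ℕ.*-monoˡ-≤ (suc D) (ℕ.≤-trans M≤KnX (ℕ.*-monoʳ-≤ (suc K ℕ.* suc n) X≤AD-B)))
      (ℕ.≤-reflexive (solve 4 (λ k n y d → k :* n :* y :* d := y :* (k :* d :* n)) refl (suc K) (suc n) (A ℕ.* suc D ∸ B) (suc D)))
    cross : (+ 1 ℤ.* + M) ℤ.* + (1 ℕ.* suc D) ℤ.≤ (+ A ℤ.* + suc D ℤ.+ (ℤ.- + B) ℤ.* + 1) ℤ.* + (suc KD-1 ℕ.* suc n)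
    cross = subst₂ ℤ._≤_
      (trans (ℤ.pos-* M (suc D)) (cong₂ ℤ._*_ (sym (ℤ.*-identityˡ (+ M))) (cong +_ (sym (ℕ.*-identityˡ (suc D))))))
      (trans (ℤ.pos-* (A ℕ.* suc D ∸ B) (suc KD-1 ℕ.* suc n)) (cong (ℤ._* + (suc KD-1 ℕ.* suc n)) (sym rhs-numerator)))
      (ℤ.+≤+ cross-ℕ)

open import Data.Nat using (ℕ; _≤_)
open import Data.Fin.Subset using (Subset; ∣_∣)
open import Data.List.Relation.Unary.All using (All)
open import Data.Product using (Σ; ∃; _×_)
open import Data.Rational using (ℚ; 0ℚ; _<_; _*_)
open import Relation.Binary.PropositionalEquality using (_≡_)
import Data.Rational
open import Data.Nat using (suc; z≤n; s≤s)
import Data.Nat as ℕ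
open import Data.Nat.Properties using (m^n>0; m≤m+n; ≤-trans)
open import Data.Product using (_,_)
open import Data.List using (length)

lemma3p4 : (k r : ℕ) → 2 ≤ r → r ≤ k →
    Σ ℚ λ c → (0ℚ < c) ×
      ((N : ℕ) (H : MultiHypergraph N) → All (λ e → ∣ e ∣ ≡ k) H →
       (W : Subset N) → 1 ≤ ∣ W ∣ →
       ∃ λ (f : Cut N r) →
         c * frac (inducedEdgeCount H W) ∣ W ∣ Data.Rational.≤ excess k r H f)
lemma3p4 (suc k) R@(suc (suc r0)) (s≤s (s≤s z≤n)) R≤k =
  frac 1 (K ℕ.* D) , 0<frac (s≤s z≤n) (≤-trans (m^n>0 R (suc k)) (m≤m+n D _)) , excess-bound
  where
  K D : ℕ
  K = suc k ℕ.* suc k ℕ.* 2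
  D = R ℕ.^ suc k
  excess-bound : (N : ℕ) (H : MultiHypergraph N) → All (λ e → ∣ e ∣ ≡ suc k) H →
    (W : Subset N) → 1 ≤ ∣ W ∣ →
    ∃ λ (f : Cut N R) → frac 1 (K ℕ.* D) * frac (inducedEdgeCount H W) ∣ W ∣ Data.Rational.≤ excess (suc k) R H f
  excess-bound N H ∣H∣≡k W 1≤∣W∣ =
    let f , X , B+X≤DA , M≤KnX = ∃-cut-with-excess r0 (suc k) R≤k N H ∣H∣≡k W 1≤∣W∣
    in  f , [1/KD]*[M/n]≤A-B/D (cutSize H f) (stirling2 (suc k) R ℕ.* R ℕ.! ℕ.* length H) X (inducedEdgeCount H W)
                                K D ∣ W ∣ (s≤s z≤n) (m^n>0 R (suc k)) 1≤∣W∣ B+X≤DA M≤KnX
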